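{- Let $n\ge 2$. (1) For any bistar tree on $n$ vertices with maximum degree $k_1$, $$D_{min} = \left\lfloor \tfrac14(k_1+1)^2\right\rfloor + \left\lfloor \tfrac14(n-k_1+1)^2\right\rfloor - 1 = \tfrac12 k_1(k_1-n) + \tfrac14\left[n(n+2)+q'\right]-1,$$ where $q' = (k_1\bmod 2)+((n-k_1)\bmod 2)$. (2) For the balanced bistar tree on $n$ vertices, $$D_{min} = \left\lfloor \tfrac18(n+2)^2\right\rfloor - 1 = \tfrac18\left(n^2+4n-4-\phi\right),\quad \phi=(n+2)^2\bmod 8.$$ (3) For the quasistar tree on $n\ge 4$ vertices, $$D_{min} = \left\lfloor \tfrac14(n-1)^2\right\rfloor + 1 = \tfrac14\left[n(n-2)+(n\bmod 2)\right]+1.$$ (4) For the star tree on $n$ vertices, $$D_{min} = \left\lfloor \tfrac14 n^2\right\rfloor = \tfrac14\left(n^2-(n\bmod 2)\right).$$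
   Context: A linear arrangement of a tree on $n$ vertices is a bijection $\pi$ from its vertex set to $\{1,\dots,n\}$; $D(\pi)=\sum_{\{u,v\}\in E}|\pi(u)-\pi(v)|$, and $D_{min}$ is the minimum of $D(\pi)$ over all linear arrangements. A star tree on $s$ vertices has one vertex (hub) adjacent to all other $s-1$ vertices (a single vertex is a star on 1 vertex). A bistar tree on $n\ge 2$ vertices is obtained from two stars with $s_1,s_2$ vertices ($s_1+s_2=n$) by adding an edge between their hubs; its maximum degree is $k_1=\max(s_1,s_2)\ge\lceil n/2\rceil$. The balanced bistar tree is the bistar tree with $k_1=\lceil n/2\rceil$; the quasistar tree is the bistar tree with $k_1=n-2$; the star tree is the bistar with $k_1=n-1$. -}

module Defs where

open import Data.Nat using (ℕ; zero; suc; _+_; _≤_; _<ᵇ_; _≡ᵇ_; _≤ᵇ_; ∣_-_∣)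
open import Data.Bool using (Bool; true; false; _∧_; _∨_; if_then_else_)
open import Data.Fin using (Fin; toℕ)
open import Data.Fin.Permutation using (Permutation′; _⟨$⟩ʳ_)
open import Data.List using (List; []; _∷_; concatMap; map; allFin)
open import Data.Nat.ListAction using (sum)
open import Data.Product using (_×_; _,_; Σ)
open import Relation.Binary.PropositionalEquality using (_≡_)

-- A (simple, undirected) graph on the vertex set Fin n, given by its list of
-- edges; each edge {u,v} is listed exactly once as a pair (u , v).
Graph : ℕ → Set
Graph n = List (Fin n × Fin n)

-- A linear arrangement: a bijection from the vertex set Fin n to positions
-- (positions 1..n are represented by Fin n, i.e. 0..n-1; only differences matter).
Arrangement : ℕ → Set
Arrangement n = Permutation′ n

D : ∀ {n} → Graph n → Arrangement n → ℕ
D G π = sum (map (λ e → ∣ toℕ (π ⟨$⟩ʳ Data.Product.proj₁ e) - toℕ (π ⟨$⟩ʳ Data.Product.proj₂ e) ∣) G)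
  where import Data.Product

IsDmin : ∀ {n} → Graph n → ℕ → Set
IsDmin {n} G m = Σ (Arrangement n) (λ π → D G π ≡ m) × (∀ (π : Arrangement n) → m ≤ D G π)

-- Bistar tree from stars with s₁ and s₂ vertices (s₁, s₂ ≥ 1), on vertex set
-- Fin (s₁ + s₂): hub of the first star is vertex 0 with leaves 1 .. s₁-1,
-- hub of the second star is vertex s₁ with leaves s₁+1 .. s₁+s₂-1,
-- and the hubs 0 and s₁ are joined by an edge.
bistarAdj : ℕ → ℕ → ℕ → Bool
bistarAdj s₁ a b = ((a ≡ᵇ 0) ∧ (b ≤ᵇ s₁)) ∨ ((a ≡ᵇ s₁) ∧ (s₁ <ᵇ b))

bistar : (s₁ s₂ : ℕ) → Graph (s₁ + s₂)
bistar s₁ s₂ =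
  concatMap (λ u → concatMap (λ v →
      if (toℕ u <ᵇ toℕ v) ∧ bistarAdj s₁ (toℕ u) (toℕ v)
      then (u , v) ∷ [] else [])
    (allFin (s₁ + s₂)))
  (allFin (s₁ + s₂))

module Submission where

-- D of a bistar is the cost of its two stars plus the hub edge. With the hubs at p < q, the
-- leaves of a hub occupy distinct positions, so the x of them on one side cost at least
-- 1 + ⋯ + x, and those beyond the other hub pay q − p each on top. At most q − p − 1 leaves
-- fit between the hubs, and 2⌊(x + y + 1)²/4⌋ ≤ x(x + 1) + y(y + 1) then gives
-- D + 1 ≥ ⌊(s₁ + 1)²/4⌋ + ⌊(s₂ + 1)²/4⌋. Equality is attained by giving each star its own
-- block of positions with the hub in the middle. The closed forms are parity computations
-- with ⌊m²/4⌋.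

open import Defs
open import Data.Nat
open import Data.Nat.Properties
open import Data.Nat.DivMod
  using (m≡m%n+[m/n]*n; m/n*n≤m; +-distrib-/; m<n⇒m/n≡0; m*n/n≡m; m<n⇒m%n≡m; m*n%n≡0; [m+kn]%n≡m%n)
open import Data.Nat.ListAction using (sum)
open import Data.Nat.ListAction.Properties using (sum-++)
open import Data.Nat.Tactic.RingSolver using (solve-∀)
open import Data.Integer using (ℤ; +_; _-_) renaming (_+_ to _+ℤ_; _*_ to _*ℤ_)
open import Data.Integer.Properties using (pos-+; pos-*)
import Data.Integer.Tactic.RingSolver as ℤ-Ring
open import Data.Bool using (Bool; true; false; _∧_; _∨_; if_then_else_; T)
open import Data.Bool.Properties using (∨-identityʳ)
open import Data.Fin using (Fin; toℕ; fromℕ<; zero; suc)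
open import Data.Fin.Properties using (toℕ-fromℕ<; fromℕ<-toℕ; toℕ<n; toℕ-injective)
open import Data.Fin.Permutation using (Permutation′; permutation; _⟨$⟩ʳ_; _⟨$⟩ˡ_; inverseˡ; flip)
open import Data.List using (List; []; _∷_; _++_; concatMap; map; allFin; tabulate)
open import Data.List.Properties using (map-++; map-tabulate)
open import Algebra.Properties.CommutativeMonoid.Sum +-0-commutativeMonoid
  using (sum-permute) renaming (sum to ∑ᶠ)
open import Algebra.Properties.CommutativeSemigroup +-commutativeSemigroup using (xy∙z≈xz∙y)
open import Data.Product using (Σ; ∃; _×_; _,_)
open import Data.Sum using (_⊎_; inj₁; inj₂)
open import Function using (_∘_)
open import Relation.Binary using (tri<; tri≈; tri>)
open import Relation.Binary.PropositionalEquality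
open import Relation.Nullary using (yes; no; contradiction)

-- Sums over initial segments of ℕ

∑ : ℕ → (ℕ → ℕ) → ℕ
∑ zero    f = 0
∑ (suc k) f = ∑ k f + f k

∑-cong : ∀ k {f g : ℕ → ℕ} → (∀ i → i < k → f i ≡ g i) → ∑ k f ≡ ∑ k g
∑-cong zero    f≡g = refl
∑-cong (suc k) f≡g = cong₂ _+_ (∑-cong k (λ i i<k → f≡g i (m<n⇒m<1+n i<k))) (f≡g k ≤-refl)

∑-mono-≤ : ∀ k {f g : ℕ → ℕ} → (∀ i → i < k → f i ≤ g i) → ∑ k f ≤ ∑ k g
∑-mono-≤ zero    f≤g = z≤n
∑-mono-≤ (suc k) f≤g = +-mono-≤ (∑-mono-≤ k (λ i i<k → f≤g i (m<n⇒m<1+n i<k))) (f≤g k ≤-refl)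

∑-distrib-+ : ∀ k f g → ∑ k (λ i → f i + g i) ≡ ∑ k f + ∑ k g
∑-distrib-+ zero    f g = refl
∑-distrib-+ (suc k) f g rewrite ∑-distrib-+ k f g = interchange (∑ k f) (∑ k g) (f k) (g k)
  where
  interchange : ∀ a b c d → a + b + (c + d) ≡ a + c + (b + d)
  interchange = solve-∀

∑-*-distribˡ : ∀ k d f → ∑ k (λ i → d * f i) ≡ d * ∑ k f
∑-*-distribˡ zero    d f = sym (*-zeroʳ d)
∑-*-distribˡ (suc k) d f rewrite ∑-*-distribˡ k d f = sym (*-distribˡ-+ d (∑ k f) (f k))

∑-suc : ∀ k f → ∑ (suc k) f ≡ f 0 + ∑ k (f ∘ suc)
∑-suc zero    f = sym (+-identityʳ (f 0))
∑-suc (suc k) f rewrite ∑-suc k f = +-assoc (f 0) _ _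

∑-+ : ∀ m k f → ∑ (m + k) f ≡ ∑ m f + ∑ k (λ i → f (m + i))
∑-+ m zero    f rewrite +-identityʳ m = sym (+-identityʳ _)
∑-+ m (suc k) f rewrite +-suc m k | ∑-+ m k f = +-assoc (∑ m f) _ _

∑-reverse : ∀ k f → ∑ k f ≡ ∑ k (λ i → f (k ∸ suc i))
∑-reverse zero    f = refl
∑-reverse (suc k) f = begin
  ∑ k f + f k                              ≡⟨ cong (_+ f k) (∑-reverse k f) ⟩
  ∑ k (λ i → f (k ∸ suc i)) + f k          ≡⟨ +-comm _ (f k) ⟩
  f k + ∑ k (λ i → f (k ∸ suc i))          ≡⟨ ∑-suc k (λ i → f (suc k ∸ suc i)) ⟨
  ∑ (suc k) (λ i → f (suc k ∸ suc i))      ∎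
  where open ≡-Reasoning

∑-zero : ∀ k f → (∀ i → i < k → f i ≡ 0) → ∑ k f ≡ 0
∑-zero zero    f f≡0 = refl
∑-zero (suc k) f f≡0 =
  cong₂ _+_ (∑-zero k f (λ i i<k → f≡0 i (m<n⇒m<1+n i<k))) (f≡0 k ≤-refl)

∑-single : ∀ k f p → p < k → (∀ i → i < k → i ≢ p → f i ≡ 0) → ∑ k f ≡ f p
∑-single (suc k) f p p<1+k f≡0 with <-cmp p k
... | tri< p<k _ _ = trans
  (cong₂ _+_ (∑-single k f p p<k (λ i i<k → f≡0 i (m<n⇒m<1+n i<k))) (f≡0 k ≤-refl (>⇒≢ p<k)))
  (+-identityʳ (f p))
... | tri≈ _ refl _ = cong (_+ f p) (∑-zero p f (λ i i<p → f≡0 i (m<n⇒m<1+n i<p) (<⇒≢ i<p)))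
... | tri> _ _ p>k = contradiction p<1+k (≤⇒≯ p>k)

∑-const-1 : ∀ k → ∑ k (λ _ → 1) ≡ k
∑-const-1 zero    = refl
∑-const-1 (suc k) = trans (cong (_+ 1) (∑-const-1 k)) (+-comm k 1)

∑-01≤ : ∀ k c → (∀ i → c i ≤ 1) → ∑ k c ≤ k
∑-01≤ k c c≤1 = ≤-trans (∑-mono-≤ k (λ i _ → c≤1 i)) (≤-reflexive (∑-const-1 k))

-- The cost of an arrangement of a bistar

𝟙 : Bool → ℕ
𝟙 true  = 1
𝟙 false = 0

𝟙≤1 : ∀ b → 𝟙 b ≤ 1
𝟙≤1 true  = ≤-refl
𝟙≤1 false = z≤n

𝟙-<ᵇ : ∀ {m n} → m < n → 𝟙 (m <ᵇ n) ≡ 1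
𝟙-<ᵇ {m} {n} m<n with m <ᵇ n | <⇒<ᵇ m<n
... | true | _ = refl

𝟙-≮ᵇ : ∀ {m n} → n ≤ m → 𝟙 (m <ᵇ n) ≡ 0
𝟙-≮ᵇ {m} {n} n≤m with m <ᵇ n in m<ᵇn
... | false = refl
... | true  = contradiction (<ᵇ⇒< m n (subst T (sym m<ᵇn) _)) (≤⇒≯ n≤m)

sum-map-concatMap : ∀ {A B : Set} (h : B → ℕ) (g : A → List B) xs →
  sum (map h (concatMap g xs)) ≡ sum (map (λ x → sum (map h (g x))) xs)
sum-map-concatMap h g []       = refl
sum-map-concatMap h g (x ∷ xs) = begin
  sum (map h (g x ++ concatMap g xs))
    ≡⟨ cong sum (map-++ h (g x) (concatMap g xs)) ⟩
  sum (map h (g x) ++ map h (concatMap g xs))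
    ≡⟨ sum-++ (map h (g x)) (map h (concatMap g xs)) ⟩
  sum (map h (g x)) + sum (map h (concatMap g xs))
    ≡⟨ cong (_+_ (sum (map h (g x)))) (sum-map-concatMap h g xs) ⟩
  sum (map h (g x)) + sum (map (λ x → sum (map h (g x))) xs) ∎
  where open ≡-Reasoning

sum-map-singleton : ∀ {B : Set} (h : B → ℕ) b e →
  sum (map h (if b then e ∷ [] else [])) ≡ 𝟙 b * h e
sum-map-singleton h true  e = refl
sum-map-singleton h false e = refl

∑ᶠ-toℕ : ∀ n (f : Fin n → ℕ) g → (∀ k → f k ≡ g (toℕ k)) → ∑ᶠ f ≡ ∑ n g
∑ᶠ-toℕ zero    f g f≡g = refl
∑ᶠ-toℕ (suc n) f g f≡g = trans
  (cong₂ _+_ (f≡g zero) (∑ᶠ-toℕ n (f ∘ suc) (g ∘ suc) (f≡g ∘ suc)))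
  (sym (∑-suc n g))

sum-map-allFin : ∀ n (f : Fin n → ℕ) g → (∀ k → f k ≡ g (toℕ k)) →
  sum (map f (allFin n)) ≡ ∑ n g
sum-map-allFin n f g f≡g = trans (cong sum (map-tabulate (λ k → k) f)) (trans (sum-tabulate n f)
  (∑ᶠ-toℕ n f g f≡g))
  where
  sum-tabulate : ∀ n (f : Fin n → ℕ) → sum (tabulate f) ≡ ∑ᶠ f
  sum-tabulate zero    f = refl
  sum-tabulate (suc n) f = cong (_+_ (f zero)) (sum-tabulate n (f ∘ suc))

-- Outside Fin n the permutation is extended by the identity.
_⟨$⟩ℕ_ : ∀ {n} → Permutation′ n → ℕ → ℕ
_⟨$⟩ℕ_ {n} π i with i <? n
... | yes i<n = toℕ (π ⟨$⟩ʳ fromℕ< i<n)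
... | no  _   = i

⟨$⟩ℕ-toℕ : ∀ {n} (π : Permutation′ n) k → π ⟨$⟩ℕ toℕ k ≡ toℕ (π ⟨$⟩ʳ k)
⟨$⟩ℕ-toℕ {n} π k with toℕ k <? n
... | yes k<n = cong (λ l → toℕ (π ⟨$⟩ʳ l)) (fromℕ<-toℕ k k<n)
... | no  k≮n = contradiction (toℕ<n k) k≮n

module _ {n} (π : Permutation′ n) where

  ⟨$⟩ℕ-inverse : ∀ i → i < n → flip π ⟨$⟩ℕ (π ⟨$⟩ℕ i) ≡ i
  ⟨$⟩ℕ-inverse i i<n = begin
    flip π ⟨$⟩ℕ (π ⟨$⟩ℕ i)                ≡⟨ cong (λ j → flip π ⟨$⟩ℕ (π ⟨$⟩ℕ j)) (toℕ-fromℕ< i<n) ⟨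
    flip π ⟨$⟩ℕ (π ⟨$⟩ℕ toℕ k)            ≡⟨ cong (flip π ⟨$⟩ℕ_) (⟨$⟩ℕ-toℕ π k) ⟩
    flip π ⟨$⟩ℕ toℕ (π ⟨$⟩ʳ k)            ≡⟨ ⟨$⟩ℕ-toℕ (flip π) (π ⟨$⟩ʳ k) ⟩
    toℕ (π ⟨$⟩ˡ (π ⟨$⟩ʳ k))               ≡⟨ cong toℕ (inverseˡ π) ⟩
    toℕ k                                  ≡⟨ toℕ-fromℕ< i<n ⟩
    i                                      ∎
    where
    open ≡-Reasoning
    k = fromℕ< i<n

  ∑-permute : ∀ g → ∑ n (g ∘ (π ⟨$⟩ℕ_)) ≡ ∑ n g
  ∑-permute g = begin
    ∑ n (g ∘ (π ⟨$⟩ℕ_))               ≡⟨ ∑ᶠ-toℕ n _ _ (λ k → cong g (sym (⟨$⟩ℕ-toℕ π k))) ⟨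
    ∑ᶠ (λ k → g (toℕ (π ⟨$⟩ʳ k)))     ≡⟨ sum-permute (g ∘ toℕ) π ⟨
    ∑ᶠ {n} (g ∘ toℕ)                  ≡⟨ ∑ᶠ-toℕ n _ _ (λ _ → refl) ⟩
    ∑ n g                             ∎
    where open ≡-Reasoning

⟨$⟩ℕ-< : ∀ {n} (π : Permutation′ n) i → i < n → π ⟨$⟩ℕ i < n
⟨$⟩ℕ-< {n} π i i<n with i <? n
... | yes _   = toℕ<n (π ⟨$⟩ʳ _)
... | no  i≮n = contradiction i<n i≮n

starCost : ℕ → ℕ → (ℕ → ℕ) → ℕ
starCost n h c = ∑ n (λ j → c j * ∣ h - j ∣)

leaf₀ : ℕ → ℕ → ℕ
leaf₀ s₁ v = 𝟙 ((0 <ᵇ v) ∧ (v <ᵇ s₁))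

leaf₁ : ℕ → ℕ → ℕ
leaf₁ s₁ v = 𝟙 (s₁ <ᵇ v)

𝟙-<ᵇ-suc : ∀ w a → 𝟙 (w <ᵇ suc a) ≡ 𝟙 (w <ᵇ a) + 𝟙 (w ≡ᵇ a)
𝟙-<ᵇ-suc zero    zero    = refl
𝟙-<ᵇ-suc zero    (suc a) = refl
𝟙-<ᵇ-suc (suc w) zero    = refl
𝟙-<ᵇ-suc (suc w) (suc a) = 𝟙-<ᵇ-suc w a

bistarEdge-split : ∀ a' u v → 𝟙 ((u <ᵇ v) ∧ bistarAdj (suc a') u v)
  ≡ 𝟙 (u ≡ᵇ 0) * (leaf₀ (suc a') v + 𝟙 (v ≡ᵇ suc a')) + 𝟙 (u ≡ᵇ suc a') * leaf₁ (suc a') v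
bistarEdge-split a' zero zero    = refl
bistarEdge-split a' zero (suc w) = begin
  𝟙 ((w <ᵇ suc a') ∨ false)                  ≡⟨ cong 𝟙 (∨-identityʳ _) ⟩
  𝟙 (w <ᵇ suc a')                            ≡⟨ 𝟙-<ᵇ-suc w a' ⟩
  𝟙 (w <ᵇ a') + 𝟙 (w ≡ᵇ a')                  ≡⟨ trans (+-identityʳ _) (+-identityʳ _) ⟨
  𝟙 (w <ᵇ a') + 𝟙 (w ≡ᵇ a') + 0 + 0          ∎
  where open ≡-Reasoning
bistarEdge-split a' (suc u) v with u ≡ᵇ a' in u≡ᵇa'
... | false with suc u <ᵇ v
...   | true  = refl
...   | false = refl
bistarEdge-split a' (suc u) v | true with ≡ᵇ⇒≡ u a' (subst T (sym u≡ᵇa') _)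
... | refl with suc u <ᵇ v
...   | true  = refl
...   | false = refl

leaf₀+leaf₁≤1 : ∀ s v → leaf₀ s v + leaf₁ s v ≤ 1
leaf₀+leaf₁≤1 s v with 0 <ᵇ v | v <ᵇ s in v<ᵇs | s <ᵇ v in s<ᵇv
... | false | _     | b     = 𝟙≤1 b
... | true  | false | b     = 𝟙≤1 b
... | true  | true  | false = ≤-refl
... | true  | true  | true  =
  contradiction (<ᵇ⇒< v s (subst T (sym v<ᵇs) _)) (<⇒≯ (<ᵇ⇒< s v (subst T (sym s<ᵇv) _)))

<ᵇ-irrefl : ∀ n → (n <ᵇ n) ≡ false
<ᵇ-irrefl zero    = refl
<ᵇ-irrefl (suc n) = <ᵇ-irrefl n

∑-leaf₀ : ∀ a' k → ∑ (suc a' + k) (leaf₀ (suc a')) ≡ a'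
∑-leaf₀ a' k = begin
  ∑ (suc a' + k) (leaf₀ (suc a'))
    ≡⟨ ∑-+ (suc a') k (leaf₀ (suc a')) ⟩
  ∑ (suc a') (leaf₀ (suc a')) + ∑ k (λ i → leaf₀ (suc a') (suc a' + i))
    ≡⟨ cong₂ _+_ (∑-suc a' (leaf₀ (suc a'))) (∑-zero k _ (λ i _ → beyond i)) ⟩
  ∑ a' (λ i → 𝟙 (i <ᵇ a')) + 0
    ≡⟨ +-identityʳ _ ⟩
  ∑ a' (λ i → 𝟙 (i <ᵇ a'))
    ≡⟨ ∑-cong a' (λ i i<a' → 𝟙-<ᵇ i<a') ⟩
  ∑ a' (λ _ → 1)
    ≡⟨ ∑-const-1 a' ⟩
  a' ∎
  where
  open ≡-Reasoning
  beyond : ∀ i → 𝟙 (a' + i <ᵇ a') ≡ 0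
  beyond i = 𝟙-≮ᵇ (m≤m+n a' i)

∑-leaf₁ : ∀ s k → ∑ (s + suc k) (leaf₁ s) ≡ k
∑-leaf₁ s k = begin
  ∑ (s + suc k) (leaf₁ s)
    ≡⟨ ∑-+ s (suc k) (leaf₁ s) ⟩
  ∑ s (leaf₁ s) + ∑ (suc k) (λ i → leaf₁ s (s + i))
    ≡⟨ cong₂ _+_ (∑-zero s _ (λ i i<s → 𝟙-≮ᵇ (<⇒≤ i<s))) (∑-suc k (λ i → leaf₁ s (s + i))) ⟩
  0 + (𝟙 (s <ᵇ s + 0) + ∑ k (λ i → 𝟙 (s <ᵇ s + suc i)))
    ≡⟨ cong₂ _+_ (𝟙-≮ᵇ (≤-reflexive (+-identityʳ s))) (∑-cong k (λ i _ → 𝟙-<ᵇ (m<m+n s z<s))) ⟩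
  0 + ∑ k (λ _ → 1)
    ≡⟨ ∑-const-1 k ⟩
  k ∎
  where open ≡-Reasoning

∑-𝟙≡ᵇ : ∀ n s (f : ℕ → ℕ) → s < n → ∑ n (λ u → 𝟙 (u ≡ᵇ s) * f u) ≡ f s
∑-𝟙≡ᵇ n s f s<n = trans (∑-single n (λ u → 𝟙 (u ≡ᵇ s) * f u) s s<n (λ u _ u≢s → cong (_* f u) (𝟙≢ u≢s)))
  (trans (cong (λ b → 𝟙 b * f s) (≡ᵇ-refl s)) (+-identityʳ (f s)))
  where
  𝟙≢ : ∀ {u} → u ≢ s → 𝟙 (u ≡ᵇ s) ≡ 0
  𝟙≢ {u} u≢s with u ≡ᵇ s in eq
  ... | false = refl
  ... | true  = contradiction (≡ᵇ⇒≡ u s (subst T (sym eq) _)) u≢s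
  ≡ᵇ-refl : ∀ s → (s ≡ᵇ s) ≡ true
  ≡ᵇ-refl zero    = refl
  ≡ᵇ-refl (suc s) = ≡ᵇ-refl s

∑-two-rows : ∀ n s (A B : ℕ → ℕ) (d : ℕ → ℕ → ℕ) → 0 < n → s < n →
  ∑ n (λ u → ∑ n (λ v → (𝟙 (u ≡ᵇ 0) * A v + 𝟙 (u ≡ᵇ s) * B v) * d u v))
    ≡ ∑ n (λ v → A v * d 0 v) + ∑ n (λ v → B v * d s v)
∑-two-rows n s A B d 0<n s<n = begin
  ∑ n (λ u → ∑ n (λ v → (𝟙 (u ≡ᵇ 0) * A v + 𝟙 (u ≡ᵇ s) * B v) * d u v))
    ≡⟨ ∑-cong n (λ u _ → row u) ⟩
  ∑ n (λ u → 𝟙 (u ≡ᵇ 0) * ∑ n (λ v → A v * d u v) + 𝟙 (u ≡ᵇ s) * ∑ n (λ v → B v * d u v))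
    ≡⟨ ∑-distrib-+ n (λ u → 𝟙 (u ≡ᵇ 0) * ∑ n (λ v → A v * d u v)) (λ u → 𝟙 (u ≡ᵇ s) * ∑ n (λ v → B v * d u v)) ⟩
  ∑ n (λ u → 𝟙 (u ≡ᵇ 0) * ∑ n (λ v → A v * d u v)) + ∑ n (λ u → 𝟙 (u ≡ᵇ s) * ∑ n (λ v → B v * d u v))
    ≡⟨ cong₂ _+_ (∑-𝟙≡ᵇ n 0 (λ u → ∑ n (λ v → A v * d u v)) 0<n) (∑-𝟙≡ᵇ n s (λ u → ∑ n (λ v → B v * d u v)) s<n) ⟩
  ∑ n (λ v → A v * d 0 v) + ∑ n (λ v → B v * d s v) ∎
  where
  open ≡-Reasoning
  row : ∀ u → ∑ n (λ v → (𝟙 (u ≡ᵇ 0) * A v + 𝟙 (u ≡ᵇ s) * B v) * d u v)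
            ≡ 𝟙 (u ≡ᵇ 0) * ∑ n (λ v → A v * d u v) + 𝟙 (u ≡ᵇ s) * ∑ n (λ v → B v * d u v)
  row u = begin
    ∑ n (λ v → (x * A v + y * B v) * d u v)                ≡⟨ ∑-cong n (λ v _ → distrib (A v) (B v) (d u v)) ⟩
    ∑ n (λ v → x * (A v * d u v) + y * (B v * d u v))      ≡⟨ ∑-distrib-+ n (λ v → x * (A v * d u v)) (λ v → y * (B v * d u v)) ⟩
    ∑ n (λ v → x * (A v * d u v)) + ∑ n (λ v → y * (B v * d u v))
      ≡⟨ cong₂ _+_ (∑-*-distribˡ n x (λ v → A v * d u v)) (∑-*-distribˡ n y (λ v → B v * d u v)) ⟩
    x * ∑ n (λ v → A v * d u v) + y * ∑ n (λ v → B v * d u v) ∎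
    where
    x = 𝟙 (u ≡ᵇ 0)
    y = 𝟙 (u ≡ᵇ s)
    distrib : ∀ a b c → (x * a + y * b) * c ≡ x * (a * c) + y * (b * c)
    distrib a b c = trans (*-distribʳ-+ c (x * a) (y * b)) (cong₂ _+_ (*-assoc x a c) (*-assoc y b c))

module _ (a' b' : ℕ) (π : Permutation′ (suc a' + suc b')) where
  private
    n  = suc a' + suc b'
    s₁ = suc a'

  D-bistar-vertices : D (bistar s₁ (suc b')) π
    ≡ ∑ n (λ u → ∑ n (λ v → 𝟙 ((u <ᵇ v) ∧ bistarAdj s₁ u v) * ∣ π ⟨$⟩ℕ u - π ⟨$⟩ℕ v ∣))
  D-bistar-vertices = trans (sum-map-concatMap length row (allFin n))
    (sum-map-allFin n _ _ λ u → trans (sum-map-concatMap length (edge u) (allFin n))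
      (sum-map-allFin n _ _ λ v → trans (sum-map-singleton length (isEdge u v) (u , v))
        (cong (𝟙 ((toℕ u <ᵇ toℕ v) ∧ bistarAdj s₁ (toℕ u) (toℕ v)) *_)
          (sym (cong₂ ∣_-_∣ (⟨$⟩ℕ-toℕ π u) (⟨$⟩ℕ-toℕ π v))))))
    where
    length : Fin n × Fin n → ℕ
    length (u , v) = ∣ toℕ (π ⟨$⟩ʳ u) - toℕ (π ⟨$⟩ʳ v) ∣
    isEdge : Fin n → Fin n → Bool
    isEdge u v = (toℕ u <ᵇ toℕ v) ∧ bistarAdj s₁ (toℕ u) (toℕ v)
    edge : Fin n → Fin n → List (Fin n × Fin n)
    edge u v = if isEdge u v then (u , v) ∷ [] else []
    row : Fin n → List (Fin n × Fin n)
    row u = concatMap (edge u) (allFin n)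

  ∑-at-positions : ∀ h c → ∑ n (λ v → c v * ∣ h - π ⟨$⟩ℕ v ∣) ≡ starCost n h (c ∘ (flip π ⟨$⟩ℕ_))
  ∑-at-positions h c = trans (sym (∑-permute (flip π) _))
    (∑-cong n λ j j<n → cong (λ i → c (flip π ⟨$⟩ℕ j) * ∣ h - i ∣) (⟨$⟩ℕ-inverse (flip π) j j<n))

  D-bistar : D (bistar s₁ (suc b')) π
    ≡ starCost n (π ⟨$⟩ℕ 0) (leaf₀ s₁ ∘ (flip π ⟨$⟩ℕ_)) + starCost n (π ⟨$⟩ℕ s₁) (leaf₁ s₁ ∘ (flip π ⟨$⟩ℕ_))
      + ∣ π ⟨$⟩ℕ 0 - π ⟨$⟩ℕ s₁ ∣
  D-bistar = begin
    D (bistar s₁ (suc b')) π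
      ≡⟨ D-bistar-vertices ⟩
    ∑ n (λ u → ∑ n (λ v → 𝟙 ((u <ᵇ v) ∧ bistarAdj s₁ u v) * d u v))
      ≡⟨ ∑-cong n (λ u _ → ∑-cong n (λ v _ → cong (_* d u v) (bistarEdge-split a' u v))) ⟩
    ∑ n (λ u → ∑ n (λ v → (𝟙 (u ≡ᵇ 0) * (leaf₀ s₁ v + 𝟙 (v ≡ᵇ s₁)) + 𝟙 (u ≡ᵇ s₁) * leaf₁ s₁ v) * d u v))
      ≡⟨ ∑-two-rows n s₁ (λ v → leaf₀ s₁ v + 𝟙 (v ≡ᵇ s₁)) (leaf₁ s₁) d z<s s₁<n ⟩
    ∑ n (λ v → (leaf₀ s₁ v + 𝟙 (v ≡ᵇ s₁)) * d 0 v) + ∑ n (λ v → leaf₁ s₁ v * d s₁ v)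
      ≡⟨ cong (_+ ∑ n (λ v → leaf₁ s₁ v * d s₁ v)) hubRow ⟩
    ∑ n (λ v → leaf₀ s₁ v * d 0 v) + d 0 s₁ + ∑ n (λ v → leaf₁ s₁ v * d s₁ v)
      ≡⟨ xy∙z≈xz∙y (∑ n (λ v → leaf₀ s₁ v * d 0 v)) (d 0 s₁) (∑ n (λ v → leaf₁ s₁ v * d s₁ v)) ⟩
    ∑ n (λ v → leaf₀ s₁ v * d 0 v) + ∑ n (λ v → leaf₁ s₁ v * d s₁ v) + d 0 s₁
      ≡⟨ cong (_+ d 0 s₁) (cong₂ _+_ (∑-at-positions (π ⟨$⟩ℕ 0) (leaf₀ s₁)) (∑-at-positions (π ⟨$⟩ℕ s₁) (leaf₁ s₁))) ⟩
    starCost n (π ⟨$⟩ℕ 0) (leaf₀ s₁ ∘ (flip π ⟨$⟩ℕ_)) + starCost n (π ⟨$⟩ℕ s₁) (leaf₁ s₁ ∘ (flip π ⟨$⟩ℕ_))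
      + d 0 s₁ ∎
    where
    open ≡-Reasoning
    d : ℕ → ℕ → ℕ
    d u v = ∣ π ⟨$⟩ℕ u - π ⟨$⟩ℕ v ∣
    s₁<n : s₁ < n
    s₁<n = m<m+n s₁ z<s
    hubRow : ∑ n (λ v → (leaf₀ s₁ v + 𝟙 (v ≡ᵇ s₁)) * d 0 v) ≡ ∑ n (λ v → leaf₀ s₁ v * d 0 v) + d 0 s₁
    hubRow = trans (∑-cong n (λ v _ → *-distribʳ-+ (d 0 v) (leaf₀ s₁ v) (𝟙 (v ≡ᵇ s₁))))
      (trans (∑-distrib-+ n (λ v → leaf₀ s₁ v * d 0 v) (λ v → 𝟙 (v ≡ᵇ s₁) * d 0 v))
        (cong (_+_ (∑ n (λ v → leaf₀ s₁ v * d 0 v))) (∑-𝟙≡ᵇ n s₁ (d 0) s₁<n)))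

-- Quarter squares

⌊_²/4⌋ : ℕ → ℕ
⌊ m ²/4⌋ = m * m / 4

square-≤ : ∀ x y → (x + y + 1) * (x + y + 1) ≤ 2 * (x * suc x + y * suc y) + 1
square-≤ x y with ≤-total x y
... | inj₁ x≤y = let t , x+t≡y = m≤n⇒∃[o]m+o≡n x≤y in
  subst (λ y → (x + y + 1) * (x + y + 1) ≤ 2 * (x * suc x + y * suc y) + 1) x+t≡y
    (≤-trans (m≤m+n _ (t * t)) (≤-reflexive (gap x t)))
  where
  gap : ∀ x t → (x + (x + t) + 1) * (x + (x + t) + 1) + t * t ≡ 2 * (x * suc x + (x + t) * suc (x + t)) + 1
  gap = solve-∀
... | inj₂ y≤x = let t , y+t≡x = m≤n⇒∃[o]m+o≡n y≤x in
  subst (λ x → (x + y + 1) * (x + y + 1) ≤ 2 * (x * suc x + y * suc y) + 1) y+t≡x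
    (≤-trans (m≤m+n _ (t * t)) (≤-reflexive (gap y t)))
  where
  gap : ∀ y t → ((y + t) + y + 1) * ((y + t) + y + 1) + t * t ≡ 2 * ((y + t) * suc (y + t) + y * suc y) + 1
  gap = solve-∀

⌊²/4⌋-split : ∀ x y → 2 * ⌊ x + y + 1 ²/4⌋ ≤ x * suc x + y * suc y
⌊²/4⌋-split x y = m<1+n⇒m≤n (*-cancelˡ-< 2 _ _ (begin-strict
  2 * (2 * ⌊ m ²/4⌋)            ≡⟨ *-assoc 2 2 ⌊ m ²/4⌋ ⟨
  4 * ⌊ m ²/4⌋                  ≡⟨ *-comm 4 ⌊ m ²/4⌋ ⟩
  ⌊ m ²/4⌋ * 4                  ≤⟨ m/n*n≤m (m * m) 4 ⟩
  m * m                         ≤⟨ square-≤ x y ⟩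
  2 * S + 1                     <⟨ n<1+n (2 * S + 1) ⟩
  suc (2 * S + 1)               ≡⟨ double-suc S ⟩
  2 * suc S                     ∎))
  where
  open ≤-Reasoning
  m = x + y + 1
  S = x * suc x + y * suc y
  double-suc : ∀ S → suc (2 * S + 1) ≡ 2 * suc S
  double-suc = solve-∀

even-or-odd : ∀ k → ∃ λ t → k ≡ t + t ⊎ k ≡ suc (t + t)
even-or-odd zero = 0 , inj₁ refl
even-or-odd (suc k) with even-or-odd k
... | t , inj₁ refl = t , inj₂ refl
... | t , inj₂ refl = suc t , inj₁ (cong suc (sym (+-suc t t)))

/-unique : ∀ {m q r d} .{{_ : NonZero d}} → m ≡ r + q * d → r < d → m / d ≡ q
/-unique {q = q} {r} {d} refl r<d = begin
  (r + q * d) / d           ≡⟨ +-distrib-/ r (q * d) (subst (_< d) (sym remainders) r<d) ⟩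
  r / d + q * d / d         ≡⟨ cong₂ _+_ (m<n⇒m/n≡0 r<d) (m*n/n≡m q d) ⟩
  q                         ∎
  where
  open ≡-Reasoning
  remainders : r % d + q * d % d ≡ r
  remainders = trans (cong₂ _+_ (m<n⇒m%n≡m r<d) (m*n%n≡0 q d)) (+-identityʳ r)

%-unique : ∀ {m q r d} .{{_ : NonZero d}} → m ≡ r + q * d → r < d → m % d ≡ r
%-unique {q = q} {r} {d} refl r<d = trans ([m+kn]%n≡m%n r q d) (m<n⇒m%n≡m r<d)

⌊²/4⌋-even : ∀ t → ⌊ t + t ²/4⌋ ≡ t * t
⌊²/4⌋-even t = /-unique (square t) z<s
  where
  square : ∀ t → (t + t) * (t + t) ≡ 0 + t * t * 4
  square = solve-∀

⌊²/4⌋-odd : ∀ t → ⌊ suc (t + t) ²/4⌋ ≡ t * suc t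
⌊²/4⌋-odd t = /-unique (square t) (s≤s (s≤s z≤n))
  where
  square : ∀ t → suc (t + t) * suc (t + t) ≡ 1 + t * suc t * 4
  square = solve-∀

%2-even : ∀ t → (t + t) % 2 ≡ 0
%2-even t = %-unique {q = t} (double t) z<s
  where
  double : ∀ t → t + t ≡ 0 + t * 2
  double = solve-∀

%2-odd : ∀ t → suc (t + t) % 2 ≡ 1
%2-odd t = %-unique {q = t} (double t) (s≤s (s≤s z≤n))
  where
  double : ∀ t → suc (t + t) ≡ 1 + t * 2
  double = solve-∀

quarter-square : ∀ m → 4 * ⌊ m ²/4⌋ + m % 2 ≡ m * m
quarter-square m with even-or-odd m
... | t , inj₁ refl = trans (cong₂ (λ q p → 4 * q + p) (⌊²/4⌋-even t) (%2-even t)) (even t)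
  where
  even : ∀ t → 4 * (t * t) + 0 ≡ (t + t) * (t + t)
  even = solve-∀
... | t , inj₂ refl = trans (cong₂ (λ q p → 4 * q + p) (⌊²/4⌋-odd t) (%2-odd t)) (odd t)
  where
  odd : ∀ t → 4 * (t * suc t) + 1 ≡ suc (t + t) * suc (t + t)
  odd = solve-∀

%2-suc : ∀ m → suc m % 2 + m % 2 ≡ 1
%2-suc m with even-or-odd m
... | t , inj₁ refl = cong₂ _+_ (%2-odd t) (%2-even t)
... | t , inj₂ refl = cong₂ _+_ (%2-even t) (%2-odd t)

⌊[1+k]²/4⌋-even : ∀ s → ⌊ s + s + 1 ²/4⌋ ≡ s * suc s
⌊[1+k]²/4⌋-even s = trans (cong ⌊_²/4⌋ (+-comm (s + s) 1)) (⌊²/4⌋-odd s)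

⌊[1+k]²/4⌋-odd : ∀ s → ⌊ suc (s + s) + 1 ²/4⌋ ≡ suc s * suc s
⌊[1+k]²/4⌋-odd s = trans (cong ⌊_²/4⌋ (double s)) (⌊²/4⌋-even (suc s))
  where
  double : ∀ s → suc (s + s) + 1 ≡ suc s + suc s
  double = solve-∀

-- An optimal hub position: x neighbours on one side, suc r on the other.
⌊²/4⌋-halves : ∀ k → ∃ λ x → ∃ λ r →
  suc k ≡ x + suc r × x * suc x + suc r * suc (suc r) ≡ 2 * ⌊ suc k + 1 ²/4⌋
⌊²/4⌋-halves k with even-or-odd k
... | t , inj₁ refl = t , t , sym (+-suc t t) , trans (split t) (cong (2 *_) (sym (⌊[1+k]²/4⌋-odd t)))
  where
  split : ∀ t → t * suc t + suc t * suc (suc t) ≡ 2 * (suc t * suc t)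
  split = solve-∀
... | t , inj₂ refl = suc t , t , cong suc (sym (+-suc t t)) ,
  trans (split t) (cong (2 *_) (sym (trans (cong (λ u → ⌊ u + 1 ²/4⌋) (cong suc (sym (+-suc t t))))
                                            (⌊[1+k]²/4⌋-even (suc t)))))
  where
  split : ∀ t → suc t * suc (suc t) + suc t * suc (suc t) ≡ 2 * (suc t * suc (suc t))
  split = solve-∀

⌊²/4⌋-equal-halves : ∀ t → ⌊ t + 1 ²/4⌋ + ⌊ t + 1 ²/4⌋ ≡ (t + t + 2) * (t + t + 2) / 8
⌊²/4⌋-equal-halves t with even-or-odd t
... | s , inj₁ refl = sym (/-unique (trans (square s) (cong (λ q → 4 + (q + q) * 8) (sym (⌊[1+k]²/4⌋-even s))))
                                   (s≤s (s≤s (s≤s (s≤s (s≤s z≤n))))))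
  where
  square : ∀ s → (s + s + (s + s) + 2) * (s + s + (s + s) + 2) ≡ 4 + (s * suc s + s * suc s) * 8
  square = solve-∀
... | s , inj₂ refl = sym (/-unique (trans (square s) (cong (λ q → 0 + (q + q) * 8) (sym (⌊[1+k]²/4⌋-odd s)))) z<s)
  where
  square : ∀ s → (suc (s + s) + suc (s + s) + 2) * (suc (s + s) + suc (s + s) + 2) ≡ 0 + (suc s * suc s + suc s * suc s) * 8
  square = solve-∀

⌊²/4⌋-adjacent-halves : ∀ t → ⌊ suc t + 1 ²/4⌋ + ⌊ t + 1 ²/4⌋ ≡ (suc (t + t) + 2) * (suc (t + t) + 2) / 8
⌊²/4⌋-adjacent-halves t with even-or-odd t
... | s , inj₁ refl = sym (/-unique
  (trans (square s) (cong₂ (λ p q → 1 + (p + q) * 8) (sym (⌊[1+k]²/4⌋-odd s)) (sym (⌊[1+k]²/4⌋-even s))))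
  (s≤s (s≤s z≤n)))
  where
  square : ∀ s → (suc (s + s + (s + s)) + 2) * (suc (s + s + (s + s)) + 2) ≡ 1 + (suc s * suc s + s * suc s) * 8
  square = solve-∀
... | s , inj₂ refl = sym (/-unique
  (trans (square s) (cong₂ (λ p q → 1 + (p + q) * 8)
    (sym (trans (cong (λ u → ⌊ u + 1 ²/4⌋) (cong suc (sym (+-suc s s)))) (⌊[1+k]²/4⌋-even (suc s))))
    (sym (⌊[1+k]²/4⌋-odd s))))
  (s≤s (s≤s z≤n)))
  where
  square : ∀ s → (suc (suc (s + s) + suc (s + s)) + 2) * (suc (suc (s + s) + suc (s + s)) + 2)
    ≡ 1 + (suc s * suc (suc s) + suc s * suc s) * 8
  square = solve-∀

⌊²/4⌋-balanced : ∀ n → ⌊ ⌈ n /2⌉ + 1 ²/4⌋ + ⌊ ⌊ n /2⌋ + 1 ²/4⌋ ≡ (n + 2) * (n + 2) / 8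
⌊²/4⌋-balanced n with even-or-odd n
... | t , inj₁ refl = trans
  (cong₂ (λ u v → ⌊ u + 1 ²/4⌋ + ⌊ v + 1 ²/4⌋) (sym (n≡⌈n+n/2⌉ t)) (sym (n≡⌊n+n/2⌋ t)))
  (⌊²/4⌋-equal-halves t)
... | t , inj₂ refl = trans
  (cong₂ (λ u v → ⌊ suc u + 1 ²/4⌋ + ⌊ v + 1 ²/4⌋) (sym (n≡⌊n+n/2⌋ t)) (sym (n≡⌈n+n/2⌉ t)))
  (⌊²/4⌋-adjacent-halves t)

-- The lower bound

-- C marked points among the distances o + 1, …, o + k add up to at least (o + 1) + … + (o + C);
-- everything is doubled to stay in ℕ.
packing : ∀ k o (c : ℕ → ℕ) → (∀ i → c i ≤ 1) →
  ∑ k c * suc (∑ k c) + 2 * ∑ k c * o ≤ 2 * ∑ k (λ i → c i * suc (o + i))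
packing zero    o c c≤1 = z≤n
packing (suc k) o c c≤1 with c k | c≤1 k
... | 0 | _ = subst₂ (λ C S → C * suc C + 2 * C * o ≤ 2 * S)
                (sym (+-identityʳ (∑ k c))) (sym (+-identityʳ (∑ k (λ i → c i * suc (o + i)))))
                (packing k o c c≤1)
... | 1 | _ = begin
  (C + 1) * suc (C + 1) + 2 * (C + 1) * o   ≡⟨ expand C o ⟩
  (C * suc C + 2 * C * o) + 2 * (C + 1 + o) ≤⟨ +-mono-≤ (packing k o c c≤1) (*-monoʳ-≤ 2 (+-monoˡ-≤ o C+1≤k+1)) ⟩
  2 * S + 2 * (k + 1 + o)                   ≡⟨ collect S k o ⟩
  2 * (S + 1 * suc (o + k))                 ∎
  where
  open ≤-Reasoning
  C = ∑ k c
  S = ∑ k (λ i → c i * suc (o + i))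
  C+1≤k+1 : C + 1 ≤ k + 1
  C+1≤k+1 = +-monoˡ-≤ 1 (∑-01≤ k c c≤1)
  expand : ∀ C o → (C + 1) * suc (C + 1) + 2 * (C + 1) * o ≡ (C * suc C + 2 * C * o) + 2 * (C + 1 + o)
  expand = solve-∀
  collect : ∀ S k o → 2 * S + 2 * (k + 1 + o) ≡ 2 * (S + 1 * suc (o + k))
  collect = solve-∀
... | suc (suc _) | s≤s ()

packing-above : ∀ h o lo k (c : ℕ → ℕ) → lo ≡ suc h + o → (∀ i → c i ≤ 1) →
  let C = ∑ k (λ i → c (lo + i)) in
  C * suc C + 2 * C * o ≤ 2 * ∑ k (λ i → c (lo + i) * ∣ h - (lo + i) ∣)
packing-above h o .(suc h + o) k c refl c≤1 =
  subst (λ S → C * suc C + 2 * C * o ≤ 2 * S) (∑-cong k (λ i _ → cong (c (suc h + o + i) *_) (sym (distance i))))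
    (packing k o (λ i → c (suc h + o + i)) (c≤1 ∘ _))
  where
  C = ∑ k (λ i → c (suc h + o + i))
  distance : ∀ i → ∣ h - suc h + o + i ∣ ≡ suc (o + i)
  distance i = trans (cong (∣ h -_∣) (shift h o i)) (∣m-m+n∣≡n h (suc (o + i)))
    where
    shift : ∀ h o i → suc h + o + i ≡ h + suc (o + i)
    shift = solve-∀

packing-below : ∀ lo k o h (c : ℕ → ℕ) → h ≡ lo + k + o → (∀ i → c i ≤ 1) →
  let C = ∑ k (λ i → c (lo + i)) in
  C * suc C + 2 * C * o ≤ 2 * ∑ k (λ i → c (lo + i) * ∣ h - (lo + i) ∣)
packing-below lo k o .(lo + k + o) c refl c≤1 =
  subst₂ (λ C S → C * suc C + 2 * C * o ≤ 2 * S)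
    (sym (∑-reverse k (λ i → c (lo + i))))
    (trans (∑-cong k (λ i i<k → cong (c (lo + (k ∸ suc i)) *_) (sym (distance i i<k))))
      (sym (∑-reverse k (λ i → c (lo + i) * ∣ lo + k + o - (lo + i) ∣))))
    (packing k o (λ i → c (lo + (k ∸ suc i))) (c≤1 ∘ _))
  where
  distance : ∀ i → i < k → ∣ lo + k + o - (lo + (k ∸ suc i)) ∣ ≡ suc (o + i)
  distance i i<k with m≤n⇒∃[o]m+o≡n i<k
  ... | j , refl = begin
    ∣ lo + (suc i + j) + o - (lo + (suc i + j ∸ suc i)) ∣ ≡⟨ cong (λ x → ∣ lo + (suc i + j) + o - (lo + x) ∣) (m+n∸m≡n (suc i) j) ⟩
    ∣ lo + (suc i + j) + o - (lo + j) ∣                  ≡⟨ cong (λ x → ∣ x - lo + j ∣) (shift lo i j o) ⟩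
    ∣ lo + j + suc (o + i) - (lo + j) ∣                  ≡⟨ ∣-∣-comm (lo + j + suc (o + i)) (lo + j) ⟩
    ∣ lo + j - lo + j + suc (o + i) ∣                    ≡⟨ ∣m-m+n∣≡n (lo + j) (suc (o + i)) ⟩
    suc (o + i)                                         ∎
    where
    open ≡-Reasoning
    shift : ∀ lo i j o → lo + (suc i + j) + o ≡ lo + j + suc (o + i)
    shift = solve-∀

∑-around : ∀ p m r (f : ℕ → ℕ) → f p ≡ 0 → f (suc p + m) ≡ 0 →
  ∑ (suc (suc p + m) + r) f ≡ ∑ p f + ∑ m (λ i → f (suc p + i)) + ∑ r (λ i → f (suc (suc p + m) + i))
∑-around p m r f fp≡0 fq≡0 = begin
  ∑ (suc q + r) f                 ≡⟨ ∑-+ (suc q) r f ⟩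
  ∑ (suc p + m) f + f q + R       ≡⟨ cong (λ x → x + f q + R) (∑-+ (suc p) m f) ⟩
  ∑ p f + f p + M + f q + R       ≡⟨ cong₂ (λ x y → ∑ p f + x + M + y + R) fp≡0 fq≡0 ⟩
  ∑ p f + 0 + M + 0 + R           ≡⟨ cong (_+ R) (trans (+-identityʳ _) (cong (_+ M) (+-identityʳ _))) ⟩
  ∑ p f + M + R                   ∎
  where
  open ≡-Reasoning
  q = suc p + m
  M = ∑ m (λ i → f (suc p + i))
  R = ∑ r (λ i → f (suc q + i))

-- N, M, R count the leaves of one hub on its near side, between the hubs, and beyond
-- the other hub at distance d; Sₓ are the corresponding parts of its star cost.
hub-bound : ∀ N M R d SN SM SR → M < d →
  N * suc N + 2 * N * 0 ≤ 2 * SN → M * suc M + 2 * M * 0 ≤ 2 * SM → R * suc R + 2 * R * d ≤ 2 * SR →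
  2 * ⌊ suc (N + M + R) + 1 ²/4⌋ ≤ 2 * (SN + SM + SR) + 2 * M + 2
hub-bound N M R d SN SM SR M<d hN hM hR with m≤n⇒∃[o]m+o≡n M<d
... | e , refl = begin
  2 * ⌊ suc (N + M + R) + 1 ²/4⌋
    ≡⟨ cong (λ x → 2 * ⌊ x + 1 ²/4⌋) (regroup N M R) ⟩
  2 * ⌊ N + suc (M + R) + 1 ²/4⌋
    ≤⟨ ⌊²/4⌋-split N (suc (M + R)) ⟩
  N * suc N + suc (M + R) * suc (suc (M + R))
    ≤⟨ m≤m+n _ (2 * R * e) ⟩
  N * suc N + suc (M + R) * suc (suc (M + R)) + 2 * R * e
    ≡⟨ expand N M R e ⟩
  (N * suc N + 2 * N * 0) + (M * suc M + 2 * M * 0) + (R * suc R + 2 * R * suc (M + e)) + 2 * M + 2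
    ≤⟨ +-monoˡ-≤ 2 (+-monoˡ-≤ (2 * M) (+-mono-≤ (+-mono-≤ hN hM) hR)) ⟩
  2 * SN + 2 * SM + 2 * SR + 2 * M + 2
    ≡⟨ cong (λ x → x + 2 * M + 2) (sym (*-distrib-+₃ SN SM SR)) ⟩
  2 * (SN + SM + SR) + 2 * M + 2 ∎
  where
  open ≤-Reasoning
  regroup : ∀ N M R → suc (N + M + R) ≡ N + suc (M + R)
  regroup = solve-∀
  expand : ∀ N M R e → N * suc N + suc (M + R) * suc (suc (M + R)) + 2 * R * e
    ≡ (N * suc N + 2 * N * 0) + (M * suc M + 2 * M * 0) + (R * suc R + 2 * R * suc (M + e)) + 2 * M + 2
  expand = solve-∀
  *-distrib-+₃ : ∀ x y z → 2 * (x + y + z) ≡ 2 * x + 2 * y + 2 * z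
  *-distrib-+₃ = solve-∀

-- Split the positions at p and q; each hub is bounded by hub-bound, and the leaves of both
-- hubs lying between them share the q − p − 1 places there.
two-hub-bound : ∀ n p q (A B : ℕ → ℕ) → p < q → q < n →
  (∀ i → A i ≤ 1) → (∀ i → B i ≤ 1) → (∀ i → A i + B i ≤ 1) →
  A p ≡ 0 → A q ≡ 0 → B p ≡ 0 → B q ≡ 0 →
  2 * ⌊ suc (∑ n A) + 1 ²/4⌋ + 2 * ⌊ suc (∑ n B) + 1 ²/4⌋
    ≤ 2 * (starCost n p A + starCost n q B + ∣ p - q ∣) + 2
two-hub-bound n p q A B p<q q<n A≤1 B≤1 A+B≤1 Ap Aq Bp Bq with m≤n⇒∃[o]m+o≡n p<q
... | m , refl with m≤n⇒∃[o]m+o≡n q<n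
...   | r , refl = begin
  2 * ⌊ suc (∑ n A) + 1 ²/4⌋ + 2 * ⌊ suc (∑ n B) + 1 ²/4⌋
    ≤⟨ +-mono-≤ boundA boundB ⟩
  (2 * SA + 2 * AM + 2) + (2 * SB + 2 * BM + 2)
    ≡⟨ collect SA SB AM BM ⟩
  2 * (SA + SB) + 2 * (AM + BM) + 4
    ≤⟨ +-monoˡ-≤ 4 (+-monoʳ-≤ (2 * (SA + SB)) (*-monoʳ-≤ 2 AM+BM≤m)) ⟩
  2 * (SA + SB) + 2 * m + 4
    ≡⟨ finish SA SB m ⟩
  2 * (SA + SB + suc m) + 2
    ≡⟨ cong (λ d → 2 * (SA + SB + d) + 2) hub-distance ⟨
  2 * (SA + SB + ∣ p - q ∣) + 2 ∎
  where
  open ≤-Reasoning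
  q′ = suc p + m
  costA costB : ℕ → ℕ
  costA j = A j * ∣ p - j ∣
  costB j = B j * ∣ q′ - j ∣
  SA = starCost n p A
  SB = starCost n q′ B
  middle : (ℕ → ℕ) → ℕ
  middle f = ∑ m (λ i → f (suc p + i))
  beyond : (ℕ → ℕ) → ℕ
  beyond f = ∑ r (λ i → f (suc q′ + i))
  AM = middle A
  BM = middle B

  AM+BM≤m : AM + BM ≤ m
  AM+BM≤m = ≤-trans (≤-reflexive (sym (∑-distrib-+ m (λ i → A (suc p + i)) (λ i → B (suc p + i)))))
    (∑-01≤ m (λ i → A (suc p + i) + B (suc p + i)) (A+B≤1 ∘ _+_ (suc p)))

  boundA : 2 * ⌊ suc (∑ n A) + 1 ²/4⌋ ≤ 2 * SA + 2 * AM + 2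
  boundA = subst₂ (λ C S → 2 * ⌊ suc C + 1 ²/4⌋ ≤ 2 * S + 2 * AM + 2)
    (sym (∑-around p m r A Ap Aq))
    (sym (∑-around p m r costA (cong (_* ∣ p - p ∣) Ap) (cong (_* ∣ p - q′ ∣) Aq)))
    (hub-bound (∑ p A) AM (beyond A) (suc m) (∑ p costA) (middle costA) (beyond costA)
      (s≤s (≤-trans (m≤m+n AM BM) AM+BM≤m))
      (packing-below 0 p 0 p A (sym (+-identityʳ p)) A≤1)
      (packing-above p 0 (suc p) m A (sym (+-identityʳ (suc p))) A≤1)
      (packing-above p (suc m) (suc q′) r A (sym (+-suc (suc p) m)) A≤1))

  boundB : 2 * ⌊ suc (∑ n B) + 1 ²/4⌋ ≤ 2 * SB + 2 * BM + 2
  boundB = subst₂ (λ C S → 2 * ⌊ suc C + 1 ²/4⌋ ≤ 2 * S + 2 * BM + 2)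
    (trans (reverse₃ (beyond B) BM (∑ p B)) (sym (∑-around p m r B Bp Bq)))
    (trans (reverse₃ (beyond costB) (middle costB) (∑ p costB))
      (sym (∑-around p m r costB (cong (_* ∣ q′ - p ∣) Bp) (cong (_* ∣ q′ - q′ ∣) Bq))))
    (hub-bound (beyond B) BM (∑ p B) (suc m) (beyond costB) (middle costB) (∑ p costB)
      (s≤s (≤-trans (m≤n+m BM AM) AM+BM≤m))
      (packing-above q′ 0 (suc q′) r B (sym (+-identityʳ (suc q′))) B≤1)
      (packing-below (suc p) m 0 q′ B (sym (+-identityʳ q′)) B≤1)
      (packing-below 0 p (suc m) q′ B (sym (+-suc p m)) B≤1))
    where
    reverse₃ : ∀ x y z → x + y + z ≡ z + y + x
    reverse₃ = solve-∀

  hub-distance : ∣ p - q′ ∣ ≡ suc m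
  hub-distance = trans (cong (∣ p -_∣) (sym (+-suc p m))) (∣m-m+n∣≡n p (suc m))

  collect : ∀ SA SB AM BM → (2 * SA + 2 * AM + 2) + (2 * SB + 2 * BM + 2) ≡ 2 * (SA + SB) + 2 * (AM + BM) + 4
  collect = solve-∀
  finish : ∀ SA SB m → 2 * (SA + SB) + 2 * m + 4 ≡ 2 * (SA + SB + suc m) + 2
  finish = solve-∀

module _ (a' b' : ℕ) (π : Permutation′ (suc a' + suc b')) where
  private
    n  = suc a' + suc b'
    s₁ = suc a'
    W : ℕ → ℕ
    W = flip π ⟨$⟩ℕ_
    p = π ⟨$⟩ℕ 0
    q = π ⟨$⟩ℕ s₁
    A B : ℕ → ℕ
    A = leaf₀ s₁ ∘ W
    B = leaf₁ s₁ ∘ W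
    SA = starCost n p A
    SB = starCost n q B

    p<n : p < n
    p<n = ⟨$⟩ℕ-< π 0 z<s
    q<n : q < n
    q<n = ⟨$⟩ℕ-< π s₁ (m<m+n s₁ z<s)
    Wp : W p ≡ 0
    Wp = ⟨$⟩ℕ-inverse π 0 z<s
    Wq : W q ≡ s₁
    Wq = ⟨$⟩ℕ-inverse π s₁ (m<m+n s₁ z<s)

    Ap : A p ≡ 0
    Ap = cong (leaf₀ s₁) Wp
    Aq : A q ≡ 0
    Aq = trans (cong (leaf₀ s₁) Wq) (cong 𝟙 (<ᵇ-irrefl a'))
    Bp : B p ≡ 0
    Bp = cong (leaf₁ s₁) Wp
    Bq : B q ≡ 0
    Bq = trans (cong (leaf₁ s₁) Wq) (cong 𝟙 (<ᵇ-irrefl a'))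

    A≤1 : ∀ j → A j ≤ 1
    A≤1 j = 𝟙≤1 _
    B≤1 : ∀ j → B j ≤ 1
    B≤1 j = 𝟙≤1 _
    A+B≤1 : ∀ j → A j + B j ≤ 1
    A+B≤1 j = leaf₀+leaf₁≤1 s₁ (W j)

    #A : suc (∑ n A) ≡ suc a'
    #A = cong suc (trans (∑-permute (flip π) (leaf₀ s₁)) (∑-leaf₀ a' (suc b')))
    #B : suc (∑ n B) ≡ suc b'
    #B = cong suc (trans (∑-permute (flip π) (leaf₁ s₁)) (∑-leaf₁ s₁ b'))

    doubled : 2 * ⌊ suc a' + 1 ²/4⌋ + 2 * ⌊ suc b' + 1 ²/4⌋ ≤ 2 * (SA + SB + ∣ p - q ∣) + 2
    doubled with <-cmp p q
    ... | tri< p<q _ _ = subst₂ (λ x y → 2 * ⌊ x + 1 ²/4⌋ + 2 * ⌊ y + 1 ²/4⌋ ≤ 2 * (SA + SB + ∣ p - q ∣) + 2) #A #B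
      (two-hub-bound n p q A B p<q q<n A≤1 B≤1 A+B≤1 Ap Aq Bp Bq)
    ... | tri≈ _ p≡q _ = contradiction (trans (sym Wp) (trans (cong W p≡q) Wq)) (λ ())
    ... | tri> _ _ q<p = subst₂ _≤_
      (trans (+-comm (2 * ⌊ suc (∑ n B) + 1 ²/4⌋) (2 * ⌊ suc (∑ n A) + 1 ²/4⌋)) (cong₂ (λ x y → 2 * ⌊ x + 1 ²/4⌋ + 2 * ⌊ y + 1 ²/4⌋) #A #B))
      (cong (λ x → 2 * x + 2) (cong₂ _+_ (+-comm SB SA) (∣-∣-comm q p)))
      (two-hub-bound n q p B A q<p p<n B≤1 A≤1 (λ j → subst (_≤ 1) (+-comm (A j) (B j)) (A+B≤1 j)) Bq Bp Aq Ap)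

  bistar-lower-bound : ⌊ suc a' + 1 ²/4⌋ + ⌊ suc b' + 1 ²/4⌋ ≤ D (bistar s₁ (suc b')) π + 1
  bistar-lower-bound = *-cancelˡ-≤ 2 (begin
    2 * (⌊ suc a' + 1 ²/4⌋ + ⌊ suc b' + 1 ²/4⌋)        ≡⟨ *-distribˡ-+ 2 ⌊ suc a' + 1 ²/4⌋ _ ⟩
    2 * ⌊ suc a' + 1 ²/4⌋ + 2 * ⌊ suc b' + 1 ²/4⌋      ≤⟨ doubled ⟩
    2 * (SA + SB + ∣ p - q ∣) + 2                       ≡⟨ cong (λ x → 2 * x + 2) (D-bistar a' b' π) ⟨
    2 * D (bistar s₁ (suc b')) π + 2                    ≡⟨ *-distribˡ-+ 2 (D (bistar s₁ (suc b')) π) 1 ⟨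
    2 * (D (bistar s₁ (suc b')) π + 1)                  ∎)
    where open ≤-Reasoning

-- An optimal arrangement

transpose : ℕ → ℕ → ℕ → ℕ
transpose x y i with i ≟ x
... | yes _ = y
... | no  _ with i ≟ y
...   | yes _ = x
...   | no  _ = i

transpose-cases : ∀ x y i →
  (i ≡ x × transpose x y i ≡ y) ⊎ (i ≢ x × i ≡ y × transpose x y i ≡ x) ⊎ (i ≢ x × i ≢ y × transpose x y i ≡ i)
transpose-cases x y i with i ≟ x
... | yes i≡x = inj₁ (i≡x , refl)
... | no  i≢x with i ≟ y
...   | yes i≡y = inj₂ (inj₁ (i≢x , i≡y , refl))
...   | no  i≢y = inj₂ (inj₂ (i≢x , i≢y , refl))

transpose-preserves : ∀ (P : ℕ → Set) {x y i} → P x → P y → P i → P (transpose x y i)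
transpose-preserves P {x} {y} {i} px py pi with transpose-cases x y i
... | inj₁ (_ , t≡y)          = subst P (sym t≡y) py
... | inj₂ (inj₁ (_ , _ , t≡x)) = subst P (sym t≡x) px
... | inj₂ (inj₂ (_ , _ , t≡i)) = subst P (sym t≡i) pi

transpose-id : ∀ x y i → i ≢ x → i ≢ y → transpose x y i ≡ i
transpose-id x y i i≢x i≢y with transpose-cases x y i
... | inj₁ (i≡x , _)              = contradiction i≡x i≢x
... | inj₂ (inj₁ (_ , i≡y , _))   = contradiction i≡y i≢y
... | inj₂ (inj₂ (_ , _ , t≡i))   = t≡i

transpose-x : ∀ x y → transpose x y x ≡ y
transpose-x x y with transpose-cases x y x
... | inj₁ (_ , t≡y)              = t≡y
... | inj₂ (inj₁ (x≢x , _))       = contradiction refl x≢x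
... | inj₂ (inj₂ (x≢x , _))       = contradiction refl x≢x

transpose-y : ∀ x y → transpose x y y ≡ x
transpose-y x y with transpose-cases x y y
... | inj₁ (y≡x , t≡y)            = trans t≡y y≡x
... | inj₂ (inj₁ (_ , _ , t≡x))   = t≡x
... | inj₂ (inj₂ (_ , y≢y , _))   = contradiction refl y≢y

transpose-involutive : ∀ x y i → transpose x y (transpose x y i) ≡ i
transpose-involutive x y i with transpose-cases x y i
... | inj₁ (refl , t≡y)           = trans (cong (transpose x y) t≡y) (transpose-y i y)
... | inj₂ (inj₁ (_ , refl , t≡x)) = trans (cong (transpose x i) t≡x) (transpose-x x i)
... | inj₂ (inj₂ (i≢x , i≢y , t≡i)) = trans (cong (transpose x y) t≡i) t≡i

transpose≡x⇒≡y : ∀ x y i → transpose x y i ≡ x → i ≡ y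
transpose≡x⇒≡y x y i t≡x = trans (sym (transpose-involutive x y i)) (trans (cong (transpose x y) t≡x) (transpose-x x y))

module PermutationFromℕ {n} (f g : ℕ → ℕ) (f< : ∀ i → i < n → f i < n) (g< : ∀ i → i < n → g i < n)
         (f∘g : ∀ i → i < n → f (g i) ≡ i) (g∘f : ∀ i → i < n → g (f i) ≡ i) where

  permutationℕ : Permutation′ n
  permutationℕ = permutation
    (λ k → fromℕ< (f< (toℕ k) (toℕ<n k)))
    (λ k → fromℕ< (g< (toℕ k) (toℕ<n k)))
    (λ k → toℕ-injective (trans (toℕ-fromℕ< _) (trans (cong f (toℕ-fromℕ< _)) (f∘g (toℕ k) (toℕ<n k)))))
    (λ k → toℕ-injective (trans (toℕ-fromℕ< _) (trans (cong g (toℕ-fromℕ< _)) (g∘f (toℕ k) (toℕ<n k)))))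

  permutationℕ-⟨$⟩ℕ : ∀ i → i < n → permutationℕ ⟨$⟩ℕ i ≡ f i
  permutationℕ-⟨$⟩ℕ i i<n = trans (cong (permutationℕ ⟨$⟩ℕ_) (sym (toℕ-fromℕ< i<n)))
    (trans (⟨$⟩ℕ-toℕ permutationℕ (fromℕ< i<n)) (trans (toℕ-fromℕ< _) (cong f (toℕ-fromℕ< i<n))))

  flip-permutationℕ-⟨$⟩ℕ : ∀ i → i < n → flip permutationℕ ⟨$⟩ℕ i ≡ g i
  flip-permutationℕ-⟨$⟩ℕ i i<n = trans (cong (flip permutationℕ ⟨$⟩ℕ_) (sym (toℕ-fromℕ< i<n)))
    (trans (⟨$⟩ℕ-toℕ (flip permutationℕ) (fromℕ< i<n)) (trans (toℕ-fromℕ< _) (cong g (toℕ-fromℕ< i<n))))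

gauss : ∀ r → 2 * ∑ (suc r) (λ i → i) ≡ r * suc r
gauss zero    = refl
gauss (suc r) = trans (*-distribˡ-+ 2 (∑ (suc r) (λ i → i)) (suc r)) (trans (cong (_+ 2 * suc r) (gauss r)) (step r))
  where
  step : ∀ r → r * suc r + 2 * suc r ≡ suc r * suc (suc r)
  step = solve-∀

∑-distance-below : ∀ x → 2 * ∑ x (λ i → ∣ x - i ∣) ≡ x * suc x
∑-distance-below zero    = refl
∑-distance-below (suc x) = begin
  2 * ∑ (suc x) (λ i → ∣ suc x - i ∣)       ≡⟨ cong (2 *_) (∑-suc x (λ i → ∣ suc x - i ∣)) ⟩
  2 * (suc x + ∑ x (λ i → ∣ x - i ∣))        ≡⟨ *-distribˡ-+ 2 (suc x) _ ⟩
  2 * suc x + 2 * ∑ x (λ i → ∣ x - i ∣)      ≡⟨ cong (_+_ (2 * suc x)) (∑-distance-below x) ⟩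
  2 * suc x + x * suc x                      ≡⟨ step x ⟩
  suc x * suc (suc x)                        ∎
  where
  open ≡-Reasoning
  step : ∀ x → 2 * suc x + x * suc x ≡ suc x * suc (suc x)
  step = solve-∀

∑-distance : ∀ x r → 2 * ∑ (x + suc r) (λ i → ∣ x - i ∣) ≡ x * suc x + r * suc r
∑-distance x r = begin
  2 * ∑ (x + suc r) (λ i → ∣ x - i ∣)
    ≡⟨ cong (2 *_) (∑-+ x (suc r) (λ i → ∣ x - i ∣)) ⟩
  2 * (∑ x (λ i → ∣ x - i ∣) + ∑ (suc r) (λ i → ∣ x - x + i ∣))
    ≡⟨ *-distribˡ-+ 2 (∑ x (λ i → ∣ x - i ∣)) _ ⟩
  2 * ∑ x (λ i → ∣ x - i ∣) + 2 * ∑ (suc r) (λ i → ∣ x - x + i ∣)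
    ≡⟨ cong₂ _+_ (∑-distance-below x) (cong (2 *_) (∑-cong (suc r) (λ i _ → ∣m-m+n∣≡n x i))) ⟩
  x * suc x + 2 * ∑ (suc r) (λ i → i)
    ≡⟨ cong (_+_ (x * suc x)) (gauss r) ⟩
  x * suc x + r * suc r ∎
  where open ≡-Reasoning

-- The one vertex that may not be a leaf is the hub itself, at distance 0 from x.
hub-term : ∀ (c : ℕ → ℕ) h x j → (transpose h x j ≢ h → c (transpose h x j) ≡ 1) →
  c (transpose h x j) * ∣ x - j ∣ ≡ ∣ x - j ∣
hub-term c h x j leaf with transpose h x j ≟ h
... | yes t≡h rewrite transpose≡x⇒≡y h x j t≡h | ∣n-n∣≡0 x = *-zeroʳ (c (transpose h x x))
... | no  t≢h rewrite leaf t≢h = +-identityʳ _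

leaf₀-inner : ∀ {s v} → 0 < v → v < s → leaf₀ s v ≡ 1
leaf₀-inner {v = suc _} _ v<s = 𝟙-<ᵇ v<s

leaf₀-beyond : ∀ {s v} → s ≤ v → leaf₀ s v ≡ 0
leaf₀-beyond {v = zero}  _   = refl
leaf₀-beyond {v = suc _} s≤v = 𝟙-≮ᵇ s≤v

-- The first star fills positions 0 … a - 1 with its hub at x, the second fills a … n - 1 with
-- its hub at a + m; vertex x and vertex a + m trade places with the hubs.
module OptimalArrangement (a' b' x r₁ m r₂ : ℕ) (a≡ : suc a' ≡ x + suc r₁) (b≡ : suc b' ≡ m + suc r₂) where
  private
    a = suc a'
    n = suc a' + suc b'
    y = a + m
    x<a : x < a
    x<a = subst (x <_) (sym a≡) (m<m+n x z<s)
    a<n : a < n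
    a<n = m<m+n a z<s
    y<n : y < n
    y<n = +-monoʳ-< a (subst (m <_) (sym b≡) (m<m+n m z<s))
    a≤y : a ≤ y
    a≤y = m≤m+n a m

  place vertexAt : ℕ → ℕ
  place    = transpose a y ∘ transpose 0 x
  vertexAt = transpose 0 x ∘ transpose a y

  private
    place< : ∀ i → i < n → place i < n
    place< i i<n = transpose-preserves (_< n) a<n y<n (transpose-preserves (_< n) z<s (<-trans x<a a<n) i<n)
    vertexAt< : ∀ i → i < n → vertexAt i < n
    vertexAt< i i<n = transpose-preserves (_< n) z<s (<-trans x<a a<n) (transpose-preserves (_< n) a<n y<n i<n)
    place∘vertexAt : ∀ i → i < n → place (vertexAt i) ≡ i
    place∘vertexAt i _ = trans (cong (transpose a y) (transpose-involutive 0 x (transpose a y i))) (transpose-involutive a y i)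
    vertexAt∘place : ∀ i → i < n → vertexAt (place i) ≡ i
    vertexAt∘place i _ = trans (cong (transpose 0 x) (transpose-involutive a y (transpose 0 x i))) (transpose-involutive 0 x i)

  open PermutationFromℕ place vertexAt place< vertexAt< place∘vertexAt vertexAt∘place public
    renaming (permutationℕ to arrangement)

  private
    vertexAt-low : ∀ j → j < a → vertexAt j ≡ transpose 0 x j
    vertexAt-low j j<a = cong (transpose 0 x) (transpose-id a y j (<⇒≢ j<a) (<⇒≢ (<-≤-trans j<a a≤y)))

    transpose-high : ∀ j → a ≤ j → a ≤ transpose a y j
    transpose-high j a≤j = transpose-preserves (a ≤_) ≤-refl a≤y a≤j

    vertexAt-high : ∀ j → a ≤ j → vertexAt j ≡ transpose a y j
    vertexAt-high j a≤j = transpose-id 0 x _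
      (>⇒≢ (<-≤-trans z<s (transpose-high j a≤j))) (>⇒≢ (<-≤-trans x<a (transpose-high j a≤j)))

    cost₀ : starCost n x (leaf₀ a ∘ vertexAt) ≡ ∑ a (λ j → ∣ x - j ∣)
    cost₀ = trans (∑-+ a (suc b') _) (trans (cong₂ _+_
      (∑-cong a λ j j<a → trans (cong (λ v → leaf₀ a v * ∣ x - j ∣) (vertexAt-low j j<a))
        (hub-term (leaf₀ a) 0 x j λ t≢0 → leaf₀-inner (n≢0⇒n>0 t≢0)
          (transpose-preserves (_< a) z<s x<a j<a)))
      (∑-zero (suc b') _ λ i _ → cong (_* ∣ x - (a + i) ∣)
        (leaf₀-beyond (subst (a ≤_) (sym (vertexAt-high (a + i) (m≤m+n a i))) (transpose-high (a + i) (m≤m+n a i))))))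
      (+-identityʳ _))

    cost₁ : starCost n y (leaf₁ a ∘ vertexAt) ≡ ∑ (suc b') (λ i → ∣ m - i ∣)
    cost₁ = trans (∑-+ a (suc b') _) (cong₂ _+_
      (∑-zero a _ λ j j<a → cong (_* ∣ y - j ∣)
        (𝟙-≮ᵇ (<⇒≤ (subst (_< a) (sym (vertexAt-low j j<a)) (transpose-preserves (_< a) z<s x<a j<a)))))
      (∑-cong (suc b') λ i _ → trans (cong (λ v → leaf₁ a v * ∣ y - (a + i) ∣) (vertexAt-high (a + i) (m≤m+n a i)))
        (trans (hub-term (leaf₁ a) a y (a + i) λ t≢a →
                  𝟙-<ᵇ (≤∧≢⇒< (transpose-high (a + i) (m≤m+n a i)) (≢-sym t≢a)))
               (∣m+n-m+o∣≡∣n-o∣ a m i))))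

    hub-edge : ∣ x - y ∣ ≡ suc r₁ + m
    hub-edge = trans (cong (λ z → ∣ x - z + m ∣) a≡)
      (trans (cong (∣ x -_∣) (+-assoc x (suc r₁) m)) (∣m-m+n∣≡n x (suc r₁ + m)))

    hub₀-position : arrangement ⟨$⟩ℕ 0 ≡ x
    hub₀-position = trans (permutationℕ-⟨$⟩ℕ 0 z<s)
      (trans (cong (transpose a y) (transpose-x 0 x)) (transpose-id a y x (<⇒≢ x<a) (<⇒≢ (<-≤-trans x<a a≤y))))

    hub₁-position : arrangement ⟨$⟩ℕ a ≡ y
    hub₁-position = trans (permutationℕ-⟨$⟩ℕ a a<n)
      (trans (cong (transpose a y) (transpose-id 0 x a (λ ()) (>⇒≢ x<a))) (transpose-x a y))

    at-positions : ∀ c h → starCost n h (c ∘ (flip arrangement ⟨$⟩ℕ_)) ≡ starCost n h (c ∘ vertexAt)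
    at-positions c h = ∑-cong n λ j j<n → cong (λ v → c v * ∣ h - j ∣) (flip-permutationℕ-⟨$⟩ℕ j j<n)

  D-arrangement : 2 * D (bistar a (suc b')) arrangement + 2
    ≡ (x * suc x + suc r₁ * suc (suc r₁)) + (suc m * suc (suc m) + r₂ * suc r₂)
  D-arrangement = begin
    2 * D (bistar a (suc b')) arrangement + 2
      ≡⟨ cong (λ d → 2 * d + 2) (D-bistar a' b' arrangement) ⟩
    2 * (starCost n (arrangement ⟨$⟩ℕ 0) (leaf₀ a ∘ (flip arrangement ⟨$⟩ℕ_))
         + starCost n (arrangement ⟨$⟩ℕ a) (leaf₁ a ∘ (flip arrangement ⟨$⟩ℕ_))
         + ∣ arrangement ⟨$⟩ℕ 0 - arrangement ⟨$⟩ℕ a ∣) + 2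
      ≡⟨ cong₂ (λ p q → 2 * (starCost n p (leaf₀ a ∘ (flip arrangement ⟨$⟩ℕ_))
                              + starCost n q (leaf₁ a ∘ (flip arrangement ⟨$⟩ℕ_)) + ∣ p - q ∣) + 2)
               hub₀-position hub₁-position ⟩
    2 * (starCost n x (leaf₀ a ∘ (flip arrangement ⟨$⟩ℕ_))
         + starCost n y (leaf₁ a ∘ (flip arrangement ⟨$⟩ℕ_)) + ∣ x - y ∣) + 2
      ≡⟨ cong₂ (λ s t → 2 * (s + t + ∣ x - y ∣) + 2)
               (trans (at-positions (leaf₀ a) x) cost₀) (trans (at-positions (leaf₁ a) y) cost₁) ⟩
    2 * (∑ a (λ j → ∣ x - j ∣) + ∑ (suc b') (λ i → ∣ m - i ∣) + ∣ x - y ∣) + 2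
      ≡⟨ distribute (∑ a (λ j → ∣ x - j ∣)) (∑ (suc b') (λ i → ∣ m - i ∣)) ∣ x - y ∣ ⟩
    2 * ∑ a (λ j → ∣ x - j ∣) + 2 * ∑ (suc b') (λ i → ∣ m - i ∣) + 2 * ∣ x - y ∣ + 2
      ≡⟨ cong₂ (λ s t → s + t + 2 * ∣ x - y ∣ + 2)
               (trans (cong (λ k → 2 * ∑ k (λ j → ∣ x - j ∣)) a≡) (∑-distance x r₁))
               (trans (cong (λ k → 2 * ∑ k (λ i → ∣ m - i ∣)) b≡) (∑-distance m r₂)) ⟩
    (x * suc x + r₁ * suc r₁) + (m * suc m + r₂ * suc r₂) + 2 * ∣ x - y ∣ + 2
      ≡⟨ cong (λ e → (x * suc x + r₁ * suc r₁) + (m * suc m + r₂ * suc r₂) + 2 * e + 2) hub-edge ⟩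
    (x * suc x + r₁ * suc r₁) + (m * suc m + r₂ * suc r₂) + 2 * (suc r₁ + m) + 2
      ≡⟨ collect x r₁ m r₂ ⟩
    (x * suc x + suc r₁ * suc (suc r₁)) + (suc m * suc (suc m) + r₂ * suc r₂) ∎
    where
    open ≡-Reasoning
    distribute : ∀ s t e → 2 * (s + t + e) + 2 ≡ 2 * s + 2 * t + 2 * e + 2
    distribute = solve-∀
    collect : ∀ x r₁ m r₂ → (x * suc x + r₁ * suc r₁) + (m * suc m + r₂ * suc r₂) + 2 * (suc r₁ + m) + 2
      ≡ (x * suc x + suc r₁ * suc (suc r₁)) + (suc m * suc (suc m) + r₂ * suc r₂)
    collect = solve-∀

bistar-upper-bound : ∀ a' b' → Σ (Permutation′ (suc a' + suc b')) λ π →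
  D (bistar (suc a') (suc b')) π + 1 ≡ ⌊ suc a' + 1 ²/4⌋ + ⌊ suc b' + 1 ²/4⌋
bistar-upper-bound a' b' with ⌊²/4⌋-halves a' | ⌊²/4⌋-halves b'
... | x , r₁ , a≡ , cost₀ | r₂ , m , b≡ , cost₁ = arrangement , *-cancelˡ-≡ _ _ 2 (begin
  2 * (D (bistar (suc a') (suc b')) arrangement + 1)
    ≡⟨ *-distribˡ-+ 2 (D (bistar (suc a') (suc b')) arrangement) 1 ⟩
  2 * D (bistar (suc a') (suc b')) arrangement + 2
    ≡⟨ D-arrangement ⟩
  (x * suc x + suc r₁ * suc (suc r₁)) + (suc m * suc (suc m) + r₂ * suc r₂)
    ≡⟨ cong₂ _+_ cost₀ (trans (+-comm (suc m * suc (suc m)) (r₂ * suc r₂)) cost₁) ⟩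
  2 * ⌊ suc a' + 1 ²/4⌋ + 2 * ⌊ suc b' + 1 ²/4⌋
    ≡⟨ *-distribˡ-+ 2 ⌊ suc a' + 1 ²/4⌋ ⌊ suc b' + 1 ²/4⌋ ⟨
  2 * (⌊ suc a' + 1 ²/4⌋ + ⌊ suc b' + 1 ²/4⌋) ∎)
  where
  open ≡-Reasoning
  mirrored : suc b' ≡ m + suc r₂
  mirrored = trans b≡ (trans (+-suc r₂ m) (trans (cong suc (+-comm r₂ m)) (sym (+-suc m r₂))))
  open OptimalArrangement a' b' x r₁ m r₂ a≡ mirrored

bistar-Dmin : ∀ s₁ s₂ → 1 ≤ s₁ → 1 ≤ s₂ → IsDmin (bistar s₁ s₂) (⌊ s₁ + 1 ²/4⌋ + ⌊ s₂ + 1 ²/4⌋ ∸ 1)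
bistar-Dmin (suc a') (suc b') _ _ =
  (let π , D+1≡ = bistar-upper-bound a' b' in π , trans (sym (m+n∸n≡m _ 1)) (cong (_∸ 1) D+1≡)) ,
  λ π → m≤n+o⇒m∸n≤o _ 1 (subst (⌊ suc a' + 1 ²/4⌋ + ⌊ suc b' + 1 ²/4⌋ ≤_)
                                 (+-comm (D (bistar (suc a') (suc b')) π) 1) (bistar-lower-bound a' b' π))

-- Closed forms

quarter-squareℤ : ∀ m → + 4 *ℤ + ⌊ m ²/4⌋ +ℤ + (m % 2) ≡ + m *ℤ + m
quarter-squareℤ m = begin
  + 4 *ℤ + ⌊ m ²/4⌋ +ℤ + (m % 2)    ≡⟨ cong (_+ℤ + (m % 2)) (pos-* 4 ⌊ m ²/4⌋) ⟨
  + (4 * ⌊ m ²/4⌋) +ℤ + (m % 2)      ≡⟨ pos-+ (4 * ⌊ m ²/4⌋) (m % 2) ⟨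
  + (4 * ⌊ m ²/4⌋ + m % 2)           ≡⟨ cong +_ (quarter-square m) ⟩
  + (m * m)                          ≡⟨ pos-* m m ⟩
  + m *ℤ + m                         ∎
  where open ≡-Reasoning

%2-sucℤ : ∀ m → + (suc m % 2) +ℤ + (m % 2) ≡ + 1
%2-sucℤ m = trans (sym (pos-+ (suc m % 2) (m % 2))) (cong +_ (%2-suc m))

max-min-sum : ∀ (f : ℕ → ℕ) s₁ s₂ → f (s₁ ⊔ s₂) + f (s₁ + s₂ ∸ (s₁ ⊔ s₂)) ≡ f s₁ + f s₂
max-min-sum f s₁ s₂ with ≤-total s₁ s₂
... | inj₁ s₁≤s₂ rewrite m≤n⇒m⊔n≡n s₁≤s₂ | m+n∸n≡m s₁ s₂ = +-comm (f s₂) (f s₁)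
... | inj₂ s₂≤s₁ rewrite m≥n⇒m⊔n≡m s₂≤s₁ | m+n∸m≡n s₁ s₂ = refl

private
  module ℤ-Identities where
    bistar-form : ∀ (Qk Ql pk pl pk′ pl′ K L : ℤ) →
      + 4 *ℤ Qk +ℤ pk′ ≡ (K +ℤ + 1) *ℤ (K +ℤ + 1) → pk′ +ℤ pk ≡ + 1 →
      + 4 *ℤ Ql +ℤ pl′ ≡ (L +ℤ + 1) *ℤ (L +ℤ + 1) → pl′ +ℤ pl ≡ + 1 →
      + 4 *ℤ ((Qk +ℤ Ql) - + 1) ≡ + 2 *ℤ K *ℤ (K - (K +ℤ L)) +ℤ ((K +ℤ L) *ℤ ((K +ℤ L) +ℤ + 2) +ℤ (pk +ℤ pl)) - + 4
    bistar-form Qk Ql pk pl pk′ pl′ K L hk hpk hl hpl = begin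
      + 4 *ℤ ((Qk +ℤ Ql) - + 1)
        ≡⟨ regroup Qk Ql pk pl pk′ pl′ ⟩
      (+ 4 *ℤ Qk +ℤ pk′) +ℤ (+ 4 *ℤ Ql +ℤ pl′) - (pk′ +ℤ pk) - (pl′ +ℤ pl) +ℤ (pk +ℤ pl) - + 4
        ≡⟨ cong₂ (λ A B → A +ℤ B - (pk′ +ℤ pk) - (pl′ +ℤ pl) +ℤ (pk +ℤ pl) - + 4) hk hl ⟩
      (K +ℤ + 1) *ℤ (K +ℤ + 1) +ℤ (L +ℤ + 1) *ℤ (L +ℤ + 1) - (pk′ +ℤ pk) - (pl′ +ℤ pl) +ℤ (pk +ℤ pl) - + 4
        ≡⟨ cong₂ (λ C E → (K +ℤ + 1) *ℤ (K +ℤ + 1) +ℤ (L +ℤ + 1) *ℤ (L +ℤ + 1) - C - E +ℤ (pk +ℤ pl) - + 4) hpk hpl ⟩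
      (K +ℤ + 1) *ℤ (K +ℤ + 1) +ℤ (L +ℤ + 1) *ℤ (L +ℤ + 1) - + 1 - + 1 +ℤ (pk +ℤ pl) - + 4
        ≡⟨ expand K L (pk +ℤ pl) ⟩
      + 2 *ℤ K *ℤ (K - (K +ℤ L)) +ℤ ((K +ℤ L) *ℤ ((K +ℤ L) +ℤ + 2) +ℤ (pk +ℤ pl)) - + 4 ∎
      where
      open ≡-Reasoning
      regroup : ∀ Qk Ql pk pl pk′ pl′ → + 4 *ℤ ((Qk +ℤ Ql) - + 1)
        ≡ (+ 4 *ℤ Qk +ℤ pk′) +ℤ (+ 4 *ℤ Ql +ℤ pl′) - (pk′ +ℤ pk) - (pl′ +ℤ pl) +ℤ (pk +ℤ pl) - + 4
      regroup = ℤ-Ring.solve-∀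
      expand : ∀ K L P → (K +ℤ + 1) *ℤ (K +ℤ + 1) +ℤ (L +ℤ + 1) *ℤ (L +ℤ + 1) - + 1 - + 1 +ℤ P - + 4
        ≡ + 2 *ℤ K *ℤ (K - (K +ℤ L)) +ℤ ((K +ℤ L) *ℤ ((K +ℤ L) +ℤ + 2) +ℤ P) - + 4
      expand = ℤ-Ring.solve-∀

    balanced-form : ∀ G R X → + 8 *ℤ G +ℤ R ≡ X +ℤ + 4 → + 8 *ℤ (G - + 1) ≡ X - + 4 - R
    balanced-form G R X h = trans (regroup G R) (trans (cong (λ A → A - + 8 - R) h) (simplify X R))
      where
      regroup : ∀ G R → + 8 *ℤ (G - + 1) ≡ (+ 8 *ℤ G +ℤ R) - + 8 - R
      regroup = ℤ-Ring.solve-∀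
      simplify : ∀ X R → (X +ℤ + 4) - + 8 - R ≡ X - + 4 - R
      simplify = ℤ-Ring.solve-∀

    quasistar-form : ∀ Q p p′ n → + 4 *ℤ Q +ℤ p ≡ n *ℤ n → p′ +ℤ p ≡ + 1 →
      + 4 *ℤ ((Q +ℤ + 1) - + 1) ≡ (+ 1 +ℤ n) *ℤ ((+ 1 +ℤ n) - + 2) +ℤ p′
    quasistar-form Q p p′ n h hp = begin
      + 4 *ℤ ((Q +ℤ + 1) - + 1)             ≡⟨ regroup Q p p′ ⟩
      (+ 4 *ℤ Q +ℤ p) - (p′ +ℤ p) +ℤ p′      ≡⟨ cong₂ (λ A B → A - B +ℤ p′) h hp ⟩
      n *ℤ n - + 1 +ℤ p′                     ≡⟨ expand n p′ ⟩
      (+ 1 +ℤ n) *ℤ ((+ 1 +ℤ n) - + 2) +ℤ p′ ∎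
      where
      open ≡-Reasoning
      regroup : ∀ Q p p′ → + 4 *ℤ ((Q +ℤ + 1) - + 1) ≡ (+ 4 *ℤ Q +ℤ p) - (p′ +ℤ p) +ℤ p′
      regroup = ℤ-Ring.solve-∀
      expand : ∀ n p′ → n *ℤ n - + 1 +ℤ p′ ≡ (+ 1 +ℤ n) *ℤ ((+ 1 +ℤ n) - + 2) +ℤ p′
      expand = ℤ-Ring.solve-∀

    star-form : ∀ Q p X → + 4 *ℤ Q +ℤ p ≡ X → + 4 *ℤ Q ≡ X - p
    star-form Q p X h = trans (regroup Q p) (cong (_- p) h)
      where
      regroup : ∀ Q p → + 4 *ℤ Q ≡ (+ 4 *ℤ Q +ℤ p) - p
      regroup = ℤ-Ring.solve-∀

bistar-closed-form : ∀ k l →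
  + 4 *ℤ (+ (⌊ k + 1 ²/4⌋ + ⌊ l + 1 ²/4⌋) - + 1)
    ≡ + 2 *ℤ (+ k) *ℤ (+ k - + (k + l)) +ℤ + ((k + l) * (k + l + 2) + (k % 2 + l % 2)) - + 4
bistar-closed-form k l = begin
  + 4 *ℤ (+ (⌊ k + 1 ²/4⌋ + ⌊ l + 1 ²/4⌋) - + 1)
    ≡⟨ cong (λ v → + 4 *ℤ (v - + 1)) (pos-+ ⌊ k + 1 ²/4⌋ ⌊ l + 1 ²/4⌋) ⟩
  + 4 *ℤ ((+ ⌊ k + 1 ²/4⌋ +ℤ + ⌊ l + 1 ²/4⌋) - + 1)
    ≡⟨ ℤ-Identities.bistar-form (+ ⌊ k + 1 ²/4⌋) (+ ⌊ l + 1 ²/4⌋) (+ (k % 2)) (+ (l % 2)) (+ ((k + 1) % 2)) (+ ((l + 1) % 2))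
         (+ k) (+ l) (square k) (%2-sum k) (square l) (%2-sum l) ⟩
  + 2 *ℤ + k *ℤ (+ k - (+ k +ℤ + l)) +ℤ ((+ k +ℤ + l) *ℤ ((+ k +ℤ + l) +ℤ + 2) +ℤ (+ (k % 2) +ℤ + (l % 2))) - + 4
    ≡⟨ cong₂ (λ N X → + 2 *ℤ + k *ℤ (+ k - N) +ℤ X - + 4) (pos-+ k l) cast ⟨
  + 2 *ℤ (+ k) *ℤ (+ k - + (k + l)) +ℤ + ((k + l) * (k + l + 2) + (k % 2 + l % 2)) - + 4 ∎
  where
  open ≡-Reasoning
  square : ∀ k → + 4 *ℤ + ⌊ k + 1 ²/4⌋ +ℤ + ((k + 1) % 2) ≡ (+ k +ℤ + 1) *ℤ (+ k +ℤ + 1)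
  square k = trans (quarter-squareℤ (k + 1)) (cong (λ K → K *ℤ K) (pos-+ k 1))
  %2-sum : ∀ k → + ((k + 1) % 2) +ℤ + (k % 2) ≡ + 1
  %2-sum k = trans (cong (λ m → + (m % 2) +ℤ + (k % 2)) (+-comm k 1)) (%2-sucℤ k)
  cast : + ((k + l) * (k + l + 2) + (k % 2 + l % 2))
    ≡ (+ k +ℤ + l) *ℤ ((+ k +ℤ + l) +ℤ + 2) +ℤ (+ (k % 2) +ℤ + (l % 2))
  cast = trans (pos-+ ((k + l) * (k + l + 2)) (k % 2 + l % 2)) (cong₂ _+ℤ_
    (trans (pos-* (k + l) (k + l + 2)) (cong₂ _*ℤ_ (pos-+ k l) (trans (pos-+ (k + l) 2) (cong (_+ℤ + 2) (pos-+ k l)))))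
    (pos-+ (k % 2) (l % 2)))

balanced-closed-form : ∀ n →
  + 8 *ℤ (+ ((n + 2) * (n + 2) / 8) - + 1) ≡ + (n * n + 4 * n) - + 4 - + ((n + 2) * (n + 2) % 8)
balanced-closed-form n = ℤ-Identities.balanced-form (+ G) (+ R) (+ (n * n + 4 * n)) (begin
  + 8 *ℤ + G +ℤ + R           ≡⟨ cong (_+ℤ + R) (pos-* 8 G) ⟨
  + (8 * G) +ℤ + R            ≡⟨ pos-+ (8 * G) R ⟨
  + (8 * G + R)               ≡⟨ cong +_ (trans (+-comm (8 * G) R) (trans (cong (λ x → R + x) (*-comm 8 G))
                                    (sym (m≡m%n+[m/n]*n ((n + 2) * (n + 2)) 8)))) ⟩
  + ((n + 2) * (n + 2))       ≡⟨ cong +_ (square n) ⟩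
  + (n * n + 4 * n + 4)       ≡⟨ pos-+ (n * n + 4 * n) 4 ⟩
  + (n * n + 4 * n) +ℤ + 4    ∎)
  where
  open ≡-Reasoning
  G = (n + 2) * (n + 2) / 8
  R = (n + 2) * (n + 2) % 8
  square : ∀ n → (n + 2) * (n + 2) ≡ n * n + 4 * n + 4
  square = solve-∀

quasistar-closed-form : ∀ N → 1 ≤ N →
  + 4 *ℤ (+ (⌊ N ∸ 1 ²/4⌋ + 1) - + 1) ≡ + N *ℤ (+ N - + 2) +ℤ + (N % 2)
quasistar-closed-form (suc n) _ = begin
  + 4 *ℤ (+ (⌊ n ²/4⌋ + 1) - + 1)     ≡⟨ cong (λ v → + 4 *ℤ (v - + 1)) (pos-+ ⌊ n ²/4⌋ 1) ⟩
  + 4 *ℤ ((+ ⌊ n ²/4⌋ +ℤ + 1) - + 1)  ≡⟨ ℤ-Identities.quasistar-form (+ ⌊ n ²/4⌋) (+ (n % 2)) (+ (suc n % 2)) (+ n)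
                                          (quarter-squareℤ n) (%2-sucℤ n) ⟩
  (+ 1 +ℤ + n) *ℤ ((+ 1 +ℤ + n) - + 2) +ℤ + (suc n % 2)
                                      ≡⟨ cong (λ N → N *ℤ (N - + 2) +ℤ + (suc n % 2)) (pos-+ 1 n) ⟨
  + suc n *ℤ (+ suc n - + 2) +ℤ + (suc n % 2) ∎
  where open ≡-Reasoning

star-closed-form : ∀ N → + 4 *ℤ + ⌊ N ²/4⌋ ≡ + (N * N) - + (N % 2)
star-closed-form N = ℤ-Identities.star-form (+ ⌊ N ²/4⌋) (+ (N % 2)) (+ (N * N)) (trans (quarter-squareℤ N) (sym (pos-* N N)))

bistar-Dmin-by-max : ∀ s₁ s₂ → 1 ≤ s₁ → 1 ≤ s₂ →
  IsDmin (bistar s₁ s₂) (⌊ (s₁ ⊔ s₂) + 1 ²/4⌋ + ⌊ (s₁ + s₂ ∸ (s₁ ⊔ s₂)) + 1 ²/4⌋ ∸ 1)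
bistar-Dmin-by-max s₁ s₂ 1≤s₁ 1≤s₂ = subst (IsDmin (bistar s₁ s₂))
  (cong (_∸ 1) (sym (max-min-sum (λ k → ⌊ k + 1 ²/4⌋) s₁ s₂))) (bistar-Dmin s₁ s₂ 1≤s₁ 1≤s₂)

balanced-value : ∀ n → ⌊ ⌈ n /2⌉ + 1 ²/4⌋ + ⌊ (n ∸ ⌈ n /2⌉) + 1 ²/4⌋ ≡ (n + 2) * (n + 2) / 8
balanced-value n = trans (cong (λ m → ⌊ ⌈ n /2⌉ + 1 ²/4⌋ + ⌊ m + 1 ²/4⌋) ⌊n/2⌋≡) (⌊²/4⌋-balanced n)
  where
  ⌊n/2⌋≡ : n ∸ ⌈ n /2⌉ ≡ ⌊ n /2⌋
  ⌊n/2⌋≡ = trans (cong (_∸ ⌈ n /2⌉) (sym (⌊n/2⌋+⌈n/2⌉≡n n))) (m+n∸n≡m ⌊ n /2⌋ ⌈ n /2⌉)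

quasistar-value : ∀ N → 2 ≤ N → ⌊ (N ∸ 2) + 1 ²/4⌋ + ⌊ (N ∸ (N ∸ 2)) + 1 ²/4⌋ ∸ 1 ≡ ⌊ N ∸ 1 ²/4⌋ + 1
quasistar-value (suc (suc n)) (s≤s (s≤s z≤n)) = begin
  ⌊ n + 1 ²/4⌋ + ⌊ (2 + n ∸ n) + 1 ²/4⌋ ∸ 1   ≡⟨ cong (λ m → ⌊ n + 1 ²/4⌋ + ⌊ m + 1 ²/4⌋ ∸ 1) (m+n∸n≡m 2 n) ⟩
  ⌊ n + 1 ²/4⌋ + 2 ∸ 1                        ≡⟨ +-∸-assoc ⌊ n + 1 ²/4⌋ (s≤s z≤n) ⟩
  ⌊ n + 1 ²/4⌋ + 1                            ≡⟨ cong (λ m → ⌊ m ²/4⌋ + 1) (+-comm n 1) ⟩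
  ⌊ suc n ²/4⌋ + 1                            ∎
  where open ≡-Reasoning

star-value : ∀ N → 1 ≤ N → ⌊ (N ∸ 1) + 1 ²/4⌋ + ⌊ (N ∸ (N ∸ 1)) + 1 ²/4⌋ ∸ 1 ≡ ⌊ N ²/4⌋
star-value (suc n) (s≤s z≤n) = begin
  ⌊ n + 1 ²/4⌋ + ⌊ (1 + n ∸ n) + 1 ²/4⌋ ∸ 1   ≡⟨ cong (λ m → ⌊ n + 1 ²/4⌋ + ⌊ m + 1 ²/4⌋ ∸ 1) (m+n∸n≡m 1 n) ⟩
  ⌊ n + 1 ²/4⌋ + 1 ∸ 1                        ≡⟨ m+n∸n≡m ⌊ n + 1 ²/4⌋ 1 ⟩
  ⌊ n + 1 ²/4⌋                                ≡⟨ cong ⌊_²/4⌋ (+-comm n 1) ⟩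
  ⌊ suc n ²/4⌋                                ∎
  where open ≡-Reasoning

bistar-Dmin-closed : ∀ s₁ s₂ → 1 ≤ s₁ → 1 ≤ s₂ →
  IsDmin (bistar s₁ s₂) (⌊ (s₁ ⊔ s₂) + 1 ²/4⌋ + ⌊ (s₁ + s₂ ∸ (s₁ ⊔ s₂)) + 1 ²/4⌋ ∸ 1)
  × (+ 4 *ℤ (+ (⌊ (s₁ ⊔ s₂) + 1 ²/4⌋ + ⌊ (s₁ + s₂ ∸ (s₁ ⊔ s₂)) + 1 ²/4⌋) - + 1)
     ≡ + 2 *ℤ (+ (s₁ ⊔ s₂)) *ℤ (+ (s₁ ⊔ s₂) - + (s₁ + s₂))
       +ℤ + ((s₁ + s₂) * (s₁ + s₂ + 2) + ((s₁ ⊔ s₂) % 2 + (s₁ + s₂ ∸ (s₁ ⊔ s₂)) % 2)) - + 4)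
bistar-Dmin-closed s₁ s₂ 1≤s₁ 1≤s₂ = bistar-Dmin-by-max s₁ s₂ 1≤s₁ 1≤s₂ ,
  subst (λ N → + 4 *ℤ (+ (⌊ k + 1 ²/4⌋ + ⌊ l + 1 ²/4⌋) - + 1)
                 ≡ + 2 *ℤ (+ k) *ℤ (+ k - + N) +ℤ + (N * (N + 2) + (k % 2 + l % 2)) - + 4)
    (m+[n∸m]≡n (m⊔n≤m+n s₁ s₂)) (bistar-closed-form k l)
  where
  k = s₁ ⊔ s₂
  l = s₁ + s₂ ∸ k

balanced-bistar-Dmin : ∀ s₁ s₂ → 1 ≤ s₁ → 1 ≤ s₂ → s₁ ⊔ s₂ ≡ ⌈ s₁ + s₂ /2⌉ →
  IsDmin (bistar s₁ s₂) ((s₁ + s₂ + 2) * (s₁ + s₂ + 2) / 8 ∸ 1)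
  × (+ 8 *ℤ (+ ((s₁ + s₂ + 2) * (s₁ + s₂ + 2) / 8) - + 1)
     ≡ + ((s₁ + s₂) * (s₁ + s₂) + 4 * (s₁ + s₂)) - + 4 - + ((s₁ + s₂ + 2) * (s₁ + s₂ + 2) % 8))
balanced-bistar-Dmin s₁ s₂ 1≤s₁ 1≤s₂ k≡ =
  subst (IsDmin (bistar s₁ s₂))
    (cong (_∸ 1) (trans (cong (λ k → ⌊ k + 1 ²/4⌋ + ⌊ (s₁ + s₂ ∸ k) + 1 ²/4⌋) k≡) (balanced-value (s₁ + s₂))))
    (bistar-Dmin-by-max s₁ s₂ 1≤s₁ 1≤s₂) ,
  balanced-closed-form (s₁ + s₂)

quasistar-Dmin : ∀ s₁ s₂ → 1 ≤ s₁ → 1 ≤ s₂ → 4 ≤ s₁ + s₂ → s₁ ⊔ s₂ ≡ s₁ + s₂ ∸ 2 →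
  IsDmin (bistar s₁ s₂) (⌊ s₁ + s₂ ∸ 1 ²/4⌋ + 1)
  × (+ 4 *ℤ (+ (⌊ s₁ + s₂ ∸ 1 ²/4⌋ + 1) - + 1) ≡ + (s₁ + s₂) *ℤ (+ (s₁ + s₂) - + 2) +ℤ + ((s₁ + s₂) % 2))
quasistar-Dmin s₁ s₂ 1≤s₁ 1≤s₂ 4≤N k≡ =
  subst (IsDmin (bistar s₁ s₂))
    (trans (cong (λ k → ⌊ k + 1 ²/4⌋ + ⌊ (s₁ + s₂ ∸ k) + 1 ²/4⌋ ∸ 1) k≡) (quasistar-value (s₁ + s₂) 2≤N))
    (bistar-Dmin-by-max s₁ s₂ 1≤s₁ 1≤s₂) ,
  quasistar-closed-form (s₁ + s₂) (≤-trans (s≤s z≤n) 2≤N)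
  where
  2≤N : 2 ≤ s₁ + s₂
  2≤N = ≤-trans (s≤s (s≤s z≤n)) 4≤N

star-Dmin : ∀ s₁ s₂ → 1 ≤ s₁ → 1 ≤ s₂ → s₁ ⊔ s₂ ≡ s₁ + s₂ ∸ 1 →
  IsDmin (bistar s₁ s₂) ⌊ s₁ + s₂ ²/4⌋
  × (+ 4 *ℤ + ⌊ s₁ + s₂ ²/4⌋ ≡ + ((s₁ + s₂) * (s₁ + s₂)) - + ((s₁ + s₂) % 2))
star-Dmin s₁ s₂ 1≤s₁ 1≤s₂ k≡ =
  subst (IsDmin (bistar s₁ s₂))
    (trans (cong (λ k → ⌊ k + 1 ²/4⌋ + ⌊ (s₁ + s₂ ∸ k) + 1 ²/4⌋ ∸ 1) k≡)
      (star-value (s₁ + s₂) (≤-trans 1≤s₁ (m≤m+n s₁ s₂))))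
    (bistar-Dmin-by-max s₁ s₂ 1≤s₁ 1≤s₂) ,
  star-closed-form (s₁ + s₂)

corollary1 :
  -- (1) any bistar tree on n = s₁ + s₂ ≥ 2 vertices, k₁ = max(s₁, s₂)
  (∀ (s₁ s₂ : ℕ) → 1 ≤ s₁ → 1 ≤ s₂ →
    IsDmin (bistar s₁ s₂)
      (((s₁ ⊔ s₂) + 1) * ((s₁ ⊔ s₂) + 1) / 4
        + ((s₁ + s₂ ∸ (s₁ ⊔ s₂)) + 1) * ((s₁ + s₂ ∸ (s₁ ⊔ s₂)) + 1) / 4 ∸ 1)
    × (+ 4 *ℤ (+ (((s₁ ⊔ s₂) + 1) * ((s₁ ⊔ s₂) + 1) / 4
                + ((s₁ + s₂ ∸ (s₁ ⊔ s₂)) + 1) * ((s₁ + s₂ ∸ (s₁ ⊔ s₂)) + 1) / 4) - + 1)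
       ≡ + 2 *ℤ (+ (s₁ ⊔ s₂)) *ℤ (+ (s₁ ⊔ s₂) - + (s₁ + s₂))
         +ℤ + ((s₁ + s₂) * (s₁ + s₂ + 2)
               + ((s₁ ⊔ s₂) % 2 + (s₁ + s₂ ∸ (s₁ ⊔ s₂)) % 2))
         - + 4))
  ×
  -- (2) balanced bistar tree: k₁ = ⌈n/2⌉
  (∀ (s₁ s₂ : ℕ) → 1 ≤ s₁ → 1 ≤ s₂ → s₁ ⊔ s₂ ≡ ⌈ s₁ + s₂ /2⌉ →
    IsDmin (bistar s₁ s₂) ((s₁ + s₂ + 2) * (s₁ + s₂ + 2) / 8 ∸ 1)
    × (+ 8 *ℤ (+ ((s₁ + s₂ + 2) * (s₁ + s₂ + 2) / 8) - + 1)
       ≡ + ((s₁ + s₂) * (s₁ + s₂) + 4 * (s₁ + s₂)) - + 4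
         - + ((s₁ + s₂ + 2) * (s₁ + s₂ + 2) % 8)))
  ×
  -- (3) quasistar tree on n ≥ 4 vertices: k₁ = n - 2
  (∀ (s₁ s₂ : ℕ) → 1 ≤ s₁ → 1 ≤ s₂ → 4 ≤ s₁ + s₂ → s₁ ⊔ s₂ ≡ s₁ + s₂ ∸ 2 →
    IsDmin (bistar s₁ s₂) ((s₁ + s₂ ∸ 1) * (s₁ + s₂ ∸ 1) / 4 + 1)
    × (+ 4 *ℤ (+ ((s₁ + s₂ ∸ 1) * (s₁ + s₂ ∸ 1) / 4 + 1) - + 1)
       ≡ + (s₁ + s₂) *ℤ (+ (s₁ + s₂) - + 2) +ℤ + ((s₁ + s₂) % 2)))
  ×
  -- (4) star tree on n ≥ 2 vertices: k₁ = n - 1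
  (∀ (s₁ s₂ : ℕ) → 1 ≤ s₁ → 1 ≤ s₂ → s₁ ⊔ s₂ ≡ s₁ + s₂ ∸ 1 →
    IsDmin (bistar s₁ s₂) ((s₁ + s₂) * (s₁ + s₂) / 4)
    × (+ 4 *ℤ + ((s₁ + s₂) * (s₁ + s₂) / 4)
       ≡ + ((s₁ + s₂) * (s₁ + s₂)) - + ((s₁ + s₂) % 2)))
corollary1 = bistar-Dmin-closed , balanced-bistar-Dmin , quasistar-Dmin , star-Dmin
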